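{- The map $\alpha=\alpha(x,y,s,\cdot):H\to\mathbb{Q}[x,y,s]$ defined below satisfies the differential equation (derivative taken coefficientwise in $s$, evaluated on every matroid) $$\frac{d\alpha}{ds}=x\,\alpha\ast\delta_{\mathrm{coloop}}+y\,\delta_{\mathrm{loop}}\ast\alpha+[\delta_{\mathrm{coloop}},\alpha]_\ast-[\delta_{\mathrm{loop}},\alpha]_\ast,$$ where $[f,g]_\ast=f\ast g-g\ast f$.
   Context: For a matroid $M=(E,\mathcal{I})$ and $A\subseteq E$, $M|A$ is the restriction to $A$ and $M/A=(M^\star\setminus A)^\star$ the contraction ($M^\star$ the dual matroid). $U_{0,1}$ is the one-element loop matroid, $U_{1,1}$ the one-element coloop matroid. The matroid Hopf algebra $H$ is the $\mathbb{Q}$-vector space with basis isomorphism classes of finite matroids, product direct sum, coproduct $\Delta(M)=\sum_{A\subseteq E}M|A\otimes M/A$, counit $\epsilon(M)=1$ if $E=\emptyset$ and $0$ otherwise. For linear $f,g:H\to\mathbb{Q}[x,y,s]$, $(f\ast g)(M)=\sum_{A\subseteq E}f(M|A)g(M/A)$; for an infinitesimal character $\delta$ (i.e. $\delta(M_1\oplus M_2)=\delta(M_1)\epsilon(M_2)+\epsilon(M_1)\delta(M_2)$), $\exp_\ast(\delta)=\sum_{k\ge0}\delta^{\ast k}/k!$ with $\delta^{\ast0}=\epsilon$. $\delta_{\mathrm{loop}}(M)=1$ if $M\cong U_{0,1}$, else $0$; $\delta_{\mathrm{coloop}}(M)=1$ if $M\cong U_{1,1}$, else $0$. $\alpha(x,y,s,M)=\big(\exp_\ast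 s\{\delta_{\mathrm{coloop}}+(y-1)\delta_{\mathrm{loop}}\}\ast\exp_\ast s\{(x-1)\delta_{\mathrm{coloop}}+\delta_{\mathrm{loop}}\}\big)(M)$. -}

module Defs where

open import Data.Bool using (Bool; true; false; not; _∧_; _∨_; if_then_else_)
open import Data.Nat as ℕ using (ℕ; zero; suc; _∸_; _<_; _!)
open import Data.Nat.Properties using (_!≢0)
open import Data.Integer using (+_)
open import Data.Rational using (ℚ; 0ℚ; 1ℚ; _+_; _*_; _-_; _/_)
open import Data.Vec using (Vec; []; _∷_; lookup; replicate; _[_]≔_)
open import Data.Fin using (Fin)
open import Data.List using (List; []; _∷_; map; _++_; foldr)
open import Data.Bool.ListAction using (any; all)
open import Data.Product using (∃; _×_)
open import Relation.Binary.PropositionalEquality using (_≡_)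

-- A value  p : Poly  is given by its coefficients:  p i j k  is the
-- coefficient of  x^i y^j s^k.  (Q[x,y,s] sits inside this ring; all
-- values occurring below are polynomials.)

Poly : Set
Poly = ℕ → ℕ → ℕ → ℚ

sumTo : ℕ → (ℕ → ℚ) → ℚ
sumTo zero    f = f zero
sumTo (suc n) f = sumTo n f + f (suc n)

zeroP : Poly
zeroP _ _ _ = 0ℚ

oneP : Poly
oneP zero zero zero = 1ℚ
oneP _    _    _    = 0ℚ

xP : Poly
xP 1 zero zero = 1ℚ
xP _ _    _    = 0ℚ

yP : Poly
yP zero 1 zero = 1ℚ
yP _    _ _    = 0ℚ

sP : Poly
sP zero zero 1 = 1ℚ
sP _    _    _ = 0ℚ

_+P_ : Poly → Poly → Poly
(p +P q) i j k = p i j k + q i j k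

_-P_ : Poly → Poly → Poly
(p -P q) i j k = p i j k - q i j k

_*P_ : Poly → Poly → Poly
(p *P q) i j k =
  sumTo i λ a → sumTo j λ b → sumTo k λ c →
    p a b c * q (i ∸ a) (j ∸ b) (k ∸ c)

dds : Poly → Poly
dds p i j k = ((+ suc k) / 1) * p i j (suc k)

Subset : ℕ → Set
Subset n = Vec Bool n

cnt : ∀ {n} → Subset n → ℕ
cnt []          = zero
cnt (true ∷ X)  = suc (cnt X)
cnt (false ∷ X) = cnt X

compl : ∀ {n} → Subset n → Subset n
compl []      = []
compl (b ∷ X) = not b ∷ compl X

_⊆ᵇ_ : ∀ {n} → Subset n → Subset n → Bool
[]      ⊆ᵇ []      = true
(a ∷ X) ⊆ᵇ (b ∷ Y) = (not a ∨ b) ∧ (X ⊆ᵇ Y)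

_≟ᵇ_ : ∀ {n} → Subset n → Subset n → Bool
X ≟ᵇ Y = (X ⊆ᵇ Y) ∧ (Y ⊆ᵇ X)

allSubsets : (n : ℕ) → List (Subset n)
allSubsets zero    = [] ∷ []
allSubsets (suc n) = map (false ∷_) (allSubsets n) ++ map (true ∷_) (allSubsets n)

_⊆_ : ∀ {n} → Subset n → Subset n → Set
_⊆_ {n} X Y = (e : Fin n) → lookup X e ≡ true → lookup Y e ≡ true

SetSys : ℕ → Set
SetSys n = Subset n → Bool

record IsMatroid {n : ℕ} (ind : SetSys n) : Set where
  field
    indep-empty : ind (replicate n false) ≡ true
    indep-hered : ∀ X Y → X ⊆ Y → ind Y ≡ true → ind X ≡ true
    indep-aug   : ∀ X Y → ind X ≡ true → ind Y ≡ true → cnt X < cnt Y →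
                  ∃ λ (e : Fin n) → lookup Y e ≡ true × lookup X e ≡ false
                                  × ind (X [ e ]≔ true) ≡ true

isBasis : ∀ {n} → SetSys n → Subset n → Bool
isBasis {n} ind B =
  ind B ∧ all (λ Y → not (ind Y ∧ (B ⊆ᵇ Y) ∧ not (Y ≟ᵇ B))) (allSubsets n)

dual : ∀ {n} → SetSys n → SetSys n
dual {n} ind X = any (λ B → isBasis ind B ∧ (X ⊆ᵇ compl B)) (allSubsets n)

expand : ∀ {n} (A : Subset n) → Subset (cnt A) → Subset n
expand []          X       = []
expand (true ∷ A)  (b ∷ X) = b ∷ expand A X
expand (false ∷ A) X       = false ∷ expand A X

-- restriction M|A, ground set A relabelled as Fin |A| (order preserved)
restrict : ∀ {n} → SetSys n → (A : Subset n) → SetSys (cnt A)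
restrict ind A X = ind (expand A X)

-- contraction M/A = (M* \ A)* = (M* | (E∖A))*
contract : ∀ {n} → SetSys n → (A : Subset n) → SetSys (cnt (compl A))
contract ind A = dual (restrict (dual ind) (compl A))

-- Linear maps H → Q[x,y,s], given by their values on (labelled)
-- matroids, and the convolution product.

Fn : Set
Fn = (n : ℕ) → SetSys n → Poly

sumL : List Poly → Poly
sumL = foldr _+P_ zeroP

_⋆_ : Fn → Fn → Fn
(f ⋆ g) n ind =
  sumL (map (λ A → f (cnt A) (restrict ind A) *P g (cnt (compl A)) (contract ind A))
            (allSubsets n))

_+F_ : Fn → Fn → Fn
(f +F g) n ind = f n ind +P g n ind

_-F_ : Fn → Fn → Fn
(f -F g) n ind = f n ind -P g n ind

_·F_ : Poly → Fn → Fn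
(p ·F f) n ind = p *P f n ind

[_,_]⋆ : Fn → Fn → Fn
[ f , g ]⋆ = (f ⋆ g) -F (g ⋆ f)

εF : Fn
εF zero    _ = oneP
εF (suc _) _ = zeroP

δloop : Fn
δloop (suc zero) ind =
  if ind (false ∷ []) ∧ not (ind (true ∷ [])) then oneP else zeroP
δloop _ _ = zeroP

δcoloop : Fn
δcoloop (suc zero) ind =
  if ind (false ∷ []) ∧ ind (true ∷ []) then oneP else zeroP
δcoloop _ _ = zeroP

pow⋆ : Fn → ℕ → Fn
pow⋆ f zero    = εF
pow⋆ f (suc m) = f ⋆ pow⋆ f m

-- Since (s δ)^{⋆m} = s^m δ^{⋆m}
-- only terms m ≤ K contribute to the coefficient of s^K, so this is the
-- (s-adically convergent) infinite sum computed coefficientwise.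
expS : Fn → Fn
expS δ n ind i j K =
  sumTo K λ m → ((+ 1) / (m !)) {{m !≢0}} * pow⋆ (sP ·F δ) m n ind i j K

constF : Poly → Fn
constF p = p ·F εF

α : Fn
α = expS (δcoloop +F ((yP -P oneP) ·F δloop))
    ⋆ expS (((xP -P oneP) ·F δcoloop) +F δloop)

module Submission where

-- Both exponentials in α have explicit values.  With
-- δA = δ_coloop + (y - 1) δ_loop and δB = (x - 1) δ_coloop + δ_loop, a
-- matroid M with n elements and rank r has
--     exp_⋆(s δA)(M) = s^n (y - 1)^{n - r},    exp_⋆(s δB)(M) = s^n (x - 1)^r,
-- because (s δ)^{⋆m}(M) = [m = n] n! · (that value), which follows by
-- peeling off one element at a time (module Exponentials).  Since
-- r(M|A) = r(A) and r(M/A) = r(M) - r(A), this gives  α(M) = s^n T_M(x, y)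
-- with T_M = Σ_A (x - 1)^{r(M) - r(A)} (y - 1)^{|A| - r(A)} the Tutte
-- polynomial (module Tutte), so the left-hand side is  n s^{n-1} T_M.
-- On the right, convolving with δ_coloop or δ_loop only sees the
-- one-element minors, so the right-hand side is a sum over the elements e
-- of terms built from α(M∖e), α(M/e) and whether e is a loop or a coloop
-- (modules Convolutions, RightHandSide); by deletion–contraction each term
-- is s^{n-1} T_M.

open import Defs
open import Data.Nat using (ℕ)
open import Relation.Binary.PropositionalEquality using (_≡_)

module FiniteSets where

  open import Defs
  open import Data.Bool using (Bool; true; false; not; _∧_; _∨_; T)
  open import Data.Bool.Properties using (not-involutive; ∨-zeroʳ; ∧-zeroʳ; ¬-not)
  open import Data.Nat using (zero; suc; _+_; _≤_; _<_; z≤n; s≤s; _<?_)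
  open import Data.Nat.Properties using (m≤n⇒m≤1+n; <⇒≱; ≮⇒≥; +-suc; suc-injective)
  open import Data.Vec using ([]; _∷_; lookup; _[_]≔_)
  open import Data.Vec.Properties
    using (lookup-replicate; lookup-zipWith; tabulate∘lookup; tabulate-cong; lookup∘update; lookup∘update′)
  open import Data.Fin using (Fin; zero; suc; _≟_)
  open import Data.Fin.Subset public using (_∪_; _∩_; ⁅_⁆) renaming (⊥ to ∅; ⊤ to full)
  open import Data.Product using (∃; _×_; _,_; proj₁; proj₂)
  open import Data.Sum using (_⊎_; inj₁; inj₂)
  open import Data.Empty using (⊥-elim)
  open import Relation.Nullary using (¬_; yes; no)
  open import Data.List using (List; map)
  open import Data.List.Membership.Propositional using (_∈_; lose; find)
  open import Data.List.Membership.Propositional.Properties using (∈-map⁺; ∈-++⁺ˡ; ∈-++⁺ʳ)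
  open import Data.List.Relation.Unary.Any using (here)
  import Data.List.Relation.Unary.All as All
  open import Data.List.Relation.Unary.Any.Properties using (any⁺; any⁻)
  open import Data.List.Relation.Unary.All.Properties using (all⁺; all⁻)
  open import Data.Bool.ListAction using (any; all)
  open import Data.Bool.Properties using (T-≡)
  open import Function.Bundles using (Equivalence)
  open import Relation.Binary.PropositionalEquality

  _∋_ : ∀ {n} → Subset n → Fin n → Set
  X ∋ e = lookup X e ≡ true

  _∌_ : ∀ {n} → Subset n → Fin n → Set
  X ∌ e = lookup X e ≡ false

  true≢false : true ≢ false
  true≢false ()

  bool-cases : (b : Bool) → (b ≡ true) ⊎ (b ≡ false)
  bool-cases true  = inj₁ refl
  bool-cases false = inj₂ refl

  ⇔→≡ : ∀ {a b} → (a ≡ true → b ≡ true) → (b ≡ true → a ≡ true) → a ≡ b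
  ⇔→≡ {true}  {b}     f g = sym (f refl)
  ⇔→≡ {false} {true}  f g = g refl
  ⇔→≡ {false} {false} f g = refl

  ¬∋ : ∀ {b} → ¬ (b ≡ true) → b ≡ false
  ¬∋ = ¬-not

  ¬∌ : ∀ {b} → ¬ (b ≡ false) → b ≡ true
  ¬∌ = ¬-not

  ∨-true : ∀ {a b} → (a ∨ b) ≡ true → (a ≡ true) ⊎ (b ≡ true)
  ∨-true {true}  p = inj₁ refl
  ∨-true {false} p = inj₂ p

  ∧-true : ∀ {a b} → (a ∧ b) ≡ true → (a ≡ true) × (b ≡ true)
  ∧-true {true} {true} p = refl , refl

  lookup-∪ : ∀ {n} (X Y : Subset n) e → lookup (X ∪ Y) e ≡ lookup X e ∨ lookup Y e
  lookup-∪ X Y e = lookup-zipWith _∨_ e X Y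

  lookup-∩ : ∀ {n} (X Y : Subset n) e → lookup (X ∩ Y) e ≡ lookup X e ∧ lookup Y e
  lookup-∩ X Y e = lookup-zipWith _∧_ e X Y

  lookup-compl : ∀ {n} (X : Subset n) e → lookup (compl X) e ≡ not (lookup X e)
  lookup-compl (a ∷ X) zero    = refl
  lookup-compl (a ∷ X) (suc e) = lookup-compl X e

  ext : ∀ {n} (X Y : Subset n) → (∀ e → lookup X e ≡ lookup Y e) → X ≡ Y
  ext X Y h = trans (sym (tabulate∘lookup X)) (trans (tabulate-cong h) (tabulate∘lookup Y))

  compl-compl : ∀ {n} (X : Subset n) → compl (compl X) ≡ X
  compl-compl []      = refl
  compl-compl (a ∷ X) = cong₂ _∷_ (not-involutive a) (compl-compl X)

  compl-∅ : ∀ {n} → compl (∅ {n}) ≡ full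
  compl-∅ {zero}  = refl
  compl-∅ {suc n} = cong (true ∷_) (compl-∅ {n})

  ∅∪ : ∀ {n} (X : Subset n) → (∅ ∪ X) ≡ X
  ∅∪ []      = refl
  ∅∪ (a ∷ X) = cong (a ∷_) (∅∪ X)

  ∪-l : ∀ {n} (X Y : Subset n) e → X ∋ e → (X ∪ Y) ∋ e
  ∪-l X Y e p rewrite lookup-∪ X Y e | p = refl

  ∪-r : ∀ {n} (X Y : Subset n) e → Y ∋ e → (X ∪ Y) ∋ e
  ∪-r X Y e p rewrite lookup-∪ X Y e | p = ∨-zeroʳ (lookup X e)

  ∪-e : ∀ {n} (X Y : Subset n) e → (X ∪ Y) ∋ e → (X ∋ e) ⊎ (Y ∋ e)
  ∪-e X Y e p = ∨-true (trans (sym (lookup-∪ X Y e)) p)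

  ∩-i : ∀ {n} (X Y : Subset n) e → X ∋ e → Y ∋ e → (X ∩ Y) ∋ e
  ∩-i X Y e p q rewrite lookup-∩ X Y e | p | q = refl

  ∩-l : ∀ {n} (X Y : Subset n) e → (X ∩ Y) ∋ e → X ∋ e
  ∩-l X Y e p = proj₁ (∧-true (trans (sym (lookup-∩ X Y e)) p))

  ∩-r : ∀ {n} (X Y : Subset n) e → (X ∩ Y) ∋ e → Y ∋ e
  ∩-r X Y e p = proj₂ (∧-true {lookup X e} (trans (sym (lookup-∩ X Y e)) p))

  ∩-∌l : ∀ {n} (X Y : Subset n) e → X ∌ e → (X ∩ Y) ∌ e
  ∩-∌l X Y e p rewrite lookup-∩ X Y e | p = refl

  ∩-∌r : ∀ {n} (X Y : Subset n) e → Y ∌ e → (X ∩ Y) ∌ e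
  ∩-∌r X Y e p rewrite lookup-∩ X Y e | p = ∧-zeroʳ (lookup X e)

  ∪-∌ˡ : ∀ {n} (X Y : Subset n) e → (X ∪ Y) ∌ e → X ∌ e
  ∪-∌ˡ X Y e p = ¬∋ λ X∋e → true≢false (trans (sym (∪-l X Y e X∋e)) p)

  ∪-∌ʳ : ∀ {n} (X Y : Subset n) e → (X ∪ Y) ∌ e → Y ∌ e
  ∪-∌ʳ X Y e p = ¬∋ λ Y∋e → true≢false (trans (sym (∪-r X Y e Y∋e)) p)

  compl-∋ : ∀ {n} (X : Subset n) e → compl X ∋ e → X ∌ e
  compl-∋ X e p = trans (sym (not-involutive (lookup X e))) (cong not (trans (sym (lookup-compl X e)) p))

  compl-∌ : ∀ {n} (X : Subset n) e → X ∌ e → compl X ∋ e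
  compl-∌ X e p rewrite lookup-compl X e | p = refl

  ∋-compl : ∀ {n} (X : Subset n) e → X ∋ e → compl X ∌ e
  ∋-compl X e p rewrite lookup-compl X e | p = refl

  ⊆-refl : ∀ {n} (X : Subset n) → X ⊆ X
  ⊆-refl X e p = p

  ⊆-trans : ∀ {n} (X Y Z : Subset n) → X ⊆ Y → Y ⊆ Z → X ⊆ Z
  ⊆-trans X Y Z p q e x = q e (p e x)

  ⊆-tail : ∀ {n} {a b} (X Y : Subset n) → (a ∷ X) ⊆ (b ∷ Y) → X ⊆ Y
  ⊆-tail X Y p e x = p (suc e) x

  ∅-⊆ : ∀ {n} (X : Subset n) → ∅ ⊆ X
  ∅-⊆ X e p = ⊥-elim (true≢false (trans (sym p) (lookup-replicate e false)))

  ⊆-full : ∀ {n} (X : Subset n) → X ⊆ full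
  ⊆-full X e p = lookup-replicate e true

  ∪-⊆ : ∀ {n} (X Y Z : Subset n) → X ⊆ Z → Y ⊆ Z → (X ∪ Y) ⊆ Z
  ∪-⊆ X Y Z p q e r with ∪-e X Y e r
  ... | inj₁ a = p e a
  ... | inj₂ b = q e b

  ⊆-antisym : ∀ {n} (X Y : Subset n) → X ⊆ Y → Y ⊆ X → X ≡ Y
  ⊆-antisym X Y p q = ext X Y λ e → ⇔→≡ (p e) (q e)

  ⊆-dec : ∀ {n} (X Y : Subset n) → (X ⊆ Y) ⊎ (∃ λ e → X ∋ e × Y ∌ e)
  ⊆-dec [] [] = inj₁ (λ ())
  ⊆-dec (a ∷ X) (b ∷ Y) with ⊆-dec X Y
  ⊆-dec (true ∷ X)  (false ∷ Y) | _                = inj₂ (zero , refl , refl)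
  ⊆-dec (a ∷ X)     (b ∷ Y)     | inj₂ (e , p , q) = inj₂ (suc e , p , q)
  ⊆-dec (true ∷ X)  (true ∷ Y)  | inj₁ s = inj₁ λ { zero p → refl ; (suc e) p → s e p }
  ⊆-dec (false ∷ X) (true ∷ Y)  | inj₁ s = inj₁ λ { zero p → refl ; (suc e) p → s e p }
  ⊆-dec (false ∷ X) (false ∷ Y) | inj₁ s = inj₁ λ { zero () ; (suc e) p → s e p }

  ⊆ᵇ→⊆ : ∀ {n} (X Y : Subset n) → (X ⊆ᵇ Y) ≡ true → X ⊆ Y
  ⊆ᵇ→⊆ (true ∷ X)  (true ∷ Y)  p zero    q = refl
  ⊆ᵇ→⊆ (a ∷ X)     (b ∷ Y)     p (suc e) q = ⊆ᵇ→⊆ X Y (proj₂ (∧-true {not a ∨ b} p)) e q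
  ⊆ᵇ→⊆ (false ∷ X) (b ∷ Y)     p zero    ()
  ⊆ᵇ→⊆ (true ∷ X)  (false ∷ Y) () zero   q

  ⊆→⊆ᵇ : ∀ {n} (X Y : Subset n) → X ⊆ Y → (X ⊆ᵇ Y) ≡ true
  ⊆→⊆ᵇ [] [] p = refl
  ⊆→⊆ᵇ (true ∷ X)  (true ∷ Y)  p = ⊆→⊆ᵇ X Y (⊆-tail X Y p)
  ⊆→⊆ᵇ (true ∷ X)  (false ∷ Y) p with p zero refl
  ... | ()
  ⊆→⊆ᵇ (false ∷ X) (b ∷ Y)     p = ⊆→⊆ᵇ X Y (⊆-tail X Y p)

  ≟ᵇ-refl : ∀ {n} (X : Subset n) → (X ≟ᵇ X) ≡ true
  ≟ᵇ-refl X rewrite ⊆→⊆ᵇ X X (⊆-refl X) = refl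

  ≟ᵇ→≡ : ∀ {n} (X Y : Subset n) → (X ≟ᵇ Y) ≡ true → X ≡ Y
  ≟ᵇ→≡ X Y p with ∧-true {X ⊆ᵇ Y} p
  ... | a , b = ⊆-antisym X Y (⊆ᵇ→⊆ X Y a) (⊆ᵇ→⊆ Y X b)

  lookup-add : ∀ {n} (X : Subset n) e → (X [ e ]≔ true) ∋ e
  lookup-add X e = lookup∘update e X true

  lookup-add-other : ∀ {n} (X : Subset n) e f → e ≢ f → lookup (X [ e ]≔ true) f ≡ lookup X f
  lookup-add-other X e f e≢f = lookup∘update′ (λ f≡e → e≢f (sym f≡e)) X true

  ⊆-add : ∀ {n} (X : Subset n) e → X ⊆ (X [ e ]≔ true)
  ⊆-add X e f p with e ≟ f
  ... | yes refl = lookup-add X e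
  ... | no ne    = trans (lookup-add-other X e f ne) p

  add-⊆ : ∀ {n} (X Y : Subset n) e → X ⊆ Y → Y ∋ e → (X [ e ]≔ true) ⊆ Y
  add-⊆ X Y e s y f p with e ≟ f
  ... | yes refl = y
  ... | no ne    = s f (trans (sym (lookup-add-other X e f ne)) p)

  add-∪ : ∀ {n} (X Y : Subset n) e → ((X [ e ]≔ true) ∪ Y) ≡ ((X ∪ Y) [ e ]≔ true)
  add-∪ (a ∷ X) (b ∷ Y) zero    = refl
  add-∪ (a ∷ X) (b ∷ Y) (suc e) = cong ((a ∨ b) ∷_) (add-∪ X Y e)

  cnt≤n : ∀ {n} (X : Subset n) → cnt X ≤ n
  cnt≤n []          = z≤n
  cnt≤n (true ∷ X)  = s≤s (cnt≤n X)
  cnt≤n (false ∷ X) = m≤n⇒m≤1+n (cnt≤n X)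

  cnt-⊆ : ∀ {n} (X Y : Subset n) → X ⊆ Y → cnt X ≤ cnt Y
  cnt-⊆ [] [] p = z≤n
  cnt-⊆ (true ∷ X)  (true ∷ Y)  p = s≤s (cnt-⊆ X Y (⊆-tail X Y p))
  cnt-⊆ (true ∷ X)  (false ∷ Y) p with p zero refl
  ... | ()
  cnt-⊆ (false ∷ X) (true ∷ Y)  p = m≤n⇒m≤1+n (cnt-⊆ X Y (⊆-tail X Y p))
  cnt-⊆ (false ∷ X) (false ∷ Y) p = cnt-⊆ X Y (⊆-tail X Y p)

  ⊆-cnt : ∀ {n} (X Y : Subset n) → X ⊆ Y → cnt Y ≤ cnt X → Y ⊆ X
  ⊆-cnt [] [] p q () y
  ⊆-cnt (true ∷ X)  (true ∷ Y)  p (s≤s q) zero    y = refl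
  ⊆-cnt (true ∷ X)  (true ∷ Y)  p (s≤s q) (suc e) y = ⊆-cnt X Y (⊆-tail X Y p) q e y
  ⊆-cnt (true ∷ X)  (false ∷ Y) p q e y with p zero refl
  ... | ()
  ⊆-cnt (false ∷ X) (true ∷ Y)  p q e y = ⊥-elim (<⇒≱ (s≤s (cnt-⊆ X Y (⊆-tail X Y p))) q)
  ⊆-cnt (false ∷ X) (false ∷ Y) p q zero    ()
  ⊆-cnt (false ∷ X) (false ∷ Y) p q (suc e) y = ⊆-cnt X Y (⊆-tail X Y p) q e y

  cnt-strict : ∀ {n} (X Y : Subset n) e → X ⊆ Y → Y ∋ e → X ∌ e → cnt X < cnt Y
  cnt-strict X Y e X⊆Y Y∋e X∌e with cnt X <? cnt Y
  ... | yes lt = lt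
  ... | no ≮   = ⊥-elim (true≢false (trans (sym (⊆-cnt X Y X⊆Y (≮⇒≥ ≮) e Y∋e)) X∌e))

  cnt-add : ∀ {n} (X : Subset n) e → X ∌ e → cnt (X [ e ]≔ true) ≡ suc (cnt X)
  cnt-add (false ∷ X) zero    p = refl
  cnt-add (true ∷ X)  (suc e) p = cong suc (cnt-add X e p)
  cnt-add (false ∷ X) (suc e) p = cnt-add X e p

  cnt-∪-disjoint : ∀ {n} (X Y : Subset n) → (∀ e → X ∋ e → Y ∌ e) → cnt (X ∪ Y) ≡ cnt X + cnt Y
  cnt-∪-disjoint [] [] d = refl
  cnt-∪-disjoint (true ∷ X)  (true ∷ Y)  d with d zero refl
  ... | ()
  cnt-∪-disjoint (true ∷ X)  (false ∷ Y) d = cong suc (cnt-∪-disjoint X Y (λ e → d (suc e)))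
  cnt-∪-disjoint (false ∷ X) (true ∷ Y)  d =
    trans (cong suc (cnt-∪-disjoint X Y (λ e → d (suc e)))) (sym (+-suc (cnt X) (cnt Y)))
  cnt-∪-disjoint (false ∷ X) (false ∷ Y) d = cnt-∪-disjoint X Y (λ e → d (suc e))

  cnt-split : ∀ {n} (Y Z : Subset n) → cnt Y ≡ cnt (Y ∩ compl Z) + cnt (Y ∩ Z)
  cnt-split [] [] = refl
  cnt-split (true ∷ Y)  (true ∷ Z)  = trans (cong suc (cnt-split Y Z)) (sym (+-suc _ _))
  cnt-split (true ∷ Y)  (false ∷ Z) = cong suc (cnt-split Y Z)
  cnt-split (false ∷ Y) (true ∷ Z)  = cnt-split Y Z
  cnt-split (false ∷ Y) (false ∷ Z) = cnt-split Y Z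

  cnt-∅ : ∀ {n} → cnt (∅ {n}) ≡ 0
  cnt-∅ {zero}  = refl
  cnt-∅ {suc n} = cnt-∅ {n}

  cnt-full : ∀ {n} → cnt (full {n}) ≡ n
  cnt-full {zero}  = refl
  cnt-full {suc n} = cong suc (cnt-full {n})

  cnt-⁅⁆ : ∀ {n} (e : Fin n) → cnt ⁅ e ⁆ ≡ 1
  cnt-⁅⁆ {suc n} zero    = cong suc (cnt-∅ {n})
  cnt-⁅⁆ {suc n} (suc e) = cnt-⁅⁆ e

  cnt-compl : ∀ {n} (X : Subset n) → cnt X + cnt (compl X) ≡ n
  cnt-compl []          = refl
  cnt-compl (true ∷ X)  = cong suc (cnt-compl X)
  cnt-compl (false ∷ X) = trans (+-suc (cnt X) (cnt (compl X))) (cong suc (cnt-compl X))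

  cnt-cosingleton : ∀ {n} (e : Fin (suc n)) → cnt (compl ⁅ e ⁆) ≡ n
  cnt-cosingleton e = suc-injective (trans (cong (_+ cnt (compl ⁅ e ⁆)) (sym (cnt-⁅⁆ e))) (cnt-compl ⁅ e ⁆))

  ∈-allSubsets : ∀ {n} (X : Subset n) → X ∈ allSubsets n
  ∈-allSubsets [] = here refl
  ∈-allSubsets {suc n} (false ∷ X) = ∈-++⁺ˡ (∈-map⁺ (false ∷_) (∈-allSubsets X))
  ∈-allSubsets {suc n} (true ∷ X) =
    ∈-++⁺ʳ (map (false ∷_) (allSubsets n)) (∈-map⁺ (true ∷_) (∈-allSubsets X))

  T⇒≡ : ∀ {b} → T b → b ≡ true
  T⇒≡ = Equivalence.to T-≡

  ≡⇒T : ∀ {b} → b ≡ true → T b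
  ≡⇒T = Equivalence.from T-≡

  any-intro : ∀ {A : Set} (p : A → Bool) (L : List A) x → x ∈ L → p x ≡ true → any p L ≡ true
  any-intro p L x x∈L px = T⇒≡ (any⁺ p (lose x∈L (≡⇒T px)))

  any-elim : ∀ {A : Set} (p : A → Bool) (L : List A) → any p L ≡ true → ∃ λ x → p x ≡ true
  any-elim p L q with find (any⁻ p L (≡⇒T q))
  ... | x , _ , px = x , T⇒≡ px

  all-intro : ∀ {A : Set} (p : A → Bool) (L : List A) → (∀ x → p x ≡ true) → all p L ≡ true
  all-intro p L h = T⇒≡ (all⁻ p {xs = L} (All.tabulate (λ {x} _ → ≡⇒T (h x))))

  all-elim : ∀ {A : Set} (p : A → Bool) (L : List A) x → x ∈ L → all p L ≡ true → p x ≡ true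
  all-elim p L x x∈L q = T⇒≡ (All.lookup (all⁺ p L (≡⇒T q)) x∈L)

module Relabelling where

  open import Defs
  open FiniteSets
  open import Data.Bool using (true; false)
  open import Data.Vec using ([]; _∷_; lookup; _[_]≔_)
  open import Data.Nat using (suc)
  open import Data.Fin using (Fin; zero; suc)
  open import Data.Product using (∃; _,_)
  open import Relation.Binary.PropositionalEquality

  pos : ∀ {n} (A : Subset n) → Fin (cnt A) → Fin n
  pos (true ∷ A)  zero    = zero
  pos (true ∷ A)  (suc e) = suc (pos A e)
  pos (false ∷ A) e       = suc (pos A e)

  pos-∈ : ∀ {n} (A : Subset n) e → A ∋ pos A e
  pos-∈ (true ∷ A)  zero    = refl
  pos-∈ (true ∷ A)  (suc e) = pos-∈ A e
  pos-∈ (false ∷ A) e       = pos-∈ A e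

  pos-onto : ∀ {n} (A : Subset n) e → A ∋ e → ∃ λ e' → pos A e' ≡ e
  pos-onto (true ∷ A)  zero    p = zero , refl
  pos-onto (true ∷ A)  (suc e) p with pos-onto A e p
  ... | e' , q = suc e' , cong suc q
  pos-onto (false ∷ A) (suc e) p with pos-onto A e p
  ... | e' , q = e' , cong suc q

  lookup-expand : ∀ {n} (A : Subset n) X e → lookup (expand A X) (pos A e) ≡ lookup X e
  lookup-expand (true ∷ A)  (b ∷ X) zero    = refl
  lookup-expand (true ∷ A)  (b ∷ X) (suc e) = lookup-expand A X e
  lookup-expand (false ∷ A) X       e       = lookup-expand A X e

  expand-∌ : ∀ {n} (A : Subset n) X e → A ∌ e → expand A X ∌ e
  expand-∌ (true ∷ A)  (b ∷ X) (suc e) p = expand-∌ A X e p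
  expand-∌ (false ∷ A) X       zero    p = refl
  expand-∌ (false ∷ A) X       (suc e) p = expand-∌ A X e p

  expand-⊆ : ∀ {n} (A : Subset n) X → expand A X ⊆ A
  expand-⊆ A X e p = ¬∌ λ A∌e → true≢false (trans (sym p) (expand-∌ A X e A∌e))

  cnt-expand : ∀ {n} (A : Subset n) X → cnt (expand A X) ≡ cnt X
  cnt-expand []          []          = refl
  cnt-expand (true ∷ A)  (true ∷ X)  = cong suc (cnt-expand A X)
  cnt-expand (true ∷ A)  (false ∷ X) = cnt-expand A X
  cnt-expand (false ∷ A) X           = cnt-expand A X

  expand-add : ∀ {n} (A : Subset n) X e → expand A (X [ e ]≔ true) ≡ expand A X [ pos A e ]≔ true
  expand-add (true ∷ A)  (c ∷ X) zero    = refl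
  expand-add (true ∷ A)  (c ∷ X) (suc e) = cong (c ∷_) (expand-add A X e)
  expand-add (false ∷ A) X       e       = cong (false ∷_) (expand-add A X e)

  expand-mono : ∀ {n} (A : Subset n) X Y → X ⊆ Y → expand A X ⊆ expand A Y
  expand-mono A X Y s e p with pos-onto A e (expand-⊆ A X e p)
  ... | e' , refl = trans (lookup-expand A Y e') (s e' (trans (sym (lookup-expand A X e')) p))

  expand-reflects-⊆ : ∀ {n} (A : Subset n) X Y → expand A X ⊆ expand A Y → X ⊆ Y
  expand-reflects-⊆ A X Y s e p =
    trans (sym (lookup-expand A Y e)) (s (pos A e) (trans (lookup-expand A X e) p))

  shrink : ∀ {n} (A : Subset n) → Subset n → Subset (cnt A)
  shrink []          []      = []
  shrink (true ∷ A)  (b ∷ Y) = b ∷ shrink A Y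
  shrink (false ∷ A) (b ∷ Y) = shrink A Y

  expand-shrink : ∀ {n} (A : Subset n) Y → Y ⊆ A → expand A (shrink A Y) ≡ Y
  expand-shrink []          []          s = refl
  expand-shrink (true ∷ A)  (b ∷ Y)     s = cong (b ∷_) (expand-shrink A Y (⊆-tail Y A s))
  expand-shrink (false ∷ A) (false ∷ Y) s = cong (false ∷_) (expand-shrink A Y (⊆-tail Y A s))
  expand-shrink (false ∷ A) (true ∷ Y)  s with s zero refl
  ... | ()

  expand-full : ∀ {n} (A : Subset n) → expand A full ≡ A
  expand-full []          = refl
  expand-full (true ∷ A)  = cong (true ∷_) (expand-full A)
  expand-full (false ∷ A) = cong (false ∷_) (expand-full A)

  expand-∅ : ∀ {n} (A : Subset n) → expand A ∅ ≡ ∅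
  expand-∅ []          = refl
  expand-∅ (true ∷ A)  = cong (false ∷_) (expand-∅ A)
  expand-∅ (false ∷ A) = cong (false ∷_) (expand-∅ A)

module Independence where

  open import Defs
  open FiniteSets
  open import Data.Bool using (Bool; true; false; not; _∧_)
  open import Data.Nat using (ℕ; zero; suc; _+_; _≤_; _<?_)
  open import Data.Nat.Properties using (≮⇒≥; <⇒≱; m≤n+m; +-suc; +-identityʳ; +-monoʳ-≤; module ≤-Reasoning)
  open import Data.Vec using (lookup; _[_]≔_)
  open import Data.Vec.Properties using (lookup-replicate)
  open import Data.Fin.Properties using (any?)
  import Data.Bool.Properties as Bool
  open import Data.Product using (∃; _×_; _,_; proj₁; proj₂)
  open import Relation.Nullary.Decidable using (_×-dec_)
  open import Data.Sum using (_⊎_; inj₁; inj₂)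
  open import Data.Empty using (⊥; ⊥-elim)
  open import Relation.Nullary using (yes; no)
  open import Relation.Binary.PropositionalEquality hiding (J)

  record MaxIn {n} (f : SetSys n) (Y B : Subset n) : Set where
    constructor maximal
    field
      indep   : f B ≡ true
      inside  : B ⊆ Y
      no-room : ∀ e → Y ∋ e → B ∌ e → f (B [ e ]≔ true) ≡ false
  open MaxIn public

  Hereditary : ∀ {n} → SetSys n → Set
  Hereditary f = ∀ X Y → X ⊆ Y → f Y ≡ true → f X ≡ true

  -- Any set system: an independent subset I of Y extends to a maximal one,
  -- by adding elements of Y one at a time (at most n steps).
  module _ {n : ℕ} (f : SetSys n) where
    private
      can-add? : (Y I : Subset n) →
        (∃ λ e → Y ∋ e × I ∌ e × f (I [ e ]≔ true) ≡ true) ⊎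
        (∀ e → Y ∋ e → I ∌ e → f (I [ e ]≔ true) ≡ false)
      can-add? Y I with any? (λ e → (lookup Y e Bool.≟ true) ×-dec
                              ((lookup I e Bool.≟ false) ×-dec (f (I [ e ]≔ true) Bool.≟ true)))
      ... | yes w  = inj₁ w
      ... | no ¬w = inj₂ λ e Y∋e I∌e → ¬∋ (λ q → ¬w (e , Y∋e , I∌e , q))

      -- fuel bounds how many elements can still be added
      grow : (fuel : ℕ) (Y I : Subset n) → n ≤ cnt I + fuel → f I ≡ true → I ⊆ Y →
             ∃ λ B → I ⊆ B × MaxIn f Y B
      grow fuel Y I bound fI I⊆Y with can-add? Y I
      ... | inj₂ none = I , ⊆-refl I , maximal fI I⊆Y none
      grow zero Y I bound fI I⊆Y | inj₁ (e , Y∋e , I∌e , fIe) =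
        ⊥-elim (<⇒≱ (subst (_≤ n) (cnt-add I e I∌e) (cnt≤n (I [ e ]≔ true)))
                    (subst (n ≤_) (+-identityʳ _) bound))
      grow (suc fuel) Y I bound fI I⊆Y | inj₁ (e , Y∋e , I∌e , fIe)
        with grow fuel Y (I [ e ]≔ true)
               (subst (n ≤_) (trans (+-suc (cnt I) fuel) (cong (_+ fuel) (sym (cnt-add I e I∌e)))) bound)
               fIe (add-⊆ I Y e I⊆Y Y∋e)
      ... | B , Ie⊆B , mB = B , ⊆-trans I (I [ e ]≔ true) B (⊆-add I e) Ie⊆B , mB

    extend-to-maximal : (Y I : Subset n) → f I ≡ true → I ⊆ Y → ∃ λ B → I ⊆ B × MaxIn f Y B
    extend-to-maximal Y I = grow n Y I (m≤n+m n (cnt I))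

  -- Augmentation turns maximality into maximum cardinality: in a matroid
  -- every maximal independent subset of Y is at least as large as any
  -- independent subset of Y.
  module _ {n : ℕ} {ind : SetSys n} (M : IsMatroid ind) where
    open IsMatroid M

    maximal-largest : ∀ {Y B} J → MaxIn ind Y B → ind J ≡ true → J ⊆ Y → cnt J ≤ cnt B
    maximal-largest {B = B} J mB iJ J⊆Y with cnt B <? cnt J
    ... | no ≮ = ≮⇒≥ ≮
    ... | yes lt with indep-aug B J (indep mB) iJ lt
    ... | e , J∋e , B∌e , iBe =
      ⊥-elim (true≢false (trans (sym iBe) (no-room mB e (J⊆Y e J∋e) B∌e)))

    basis-unextendable : ∀ {B} J e → MaxIn ind full B → ind J ≡ true → B ⊆ J → J ∋ e → B ∌ e → ⊥
    basis-unextendable {B} J e mB iJ B⊆J J∋e B∌e =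
      <⇒≱ (cnt-strict B J e B⊆J J∋e B∌e) (maximal-largest J mB iJ (⊆-full J))

    maximal-above-basis : ∀ {B Y J} → MaxIn ind full B → B ⊆ Y → MaxIn ind Y J → MaxIn ind full J
    maximal-above-basis {B} {Y} {J} mB B⊆Y mJ = maximal (indep mJ) (⊆-full J) room
      where
      room : ∀ g → full ∋ g → J ∌ g → ind (J [ g ]≔ true) ≡ false
      room g _ J∌g with ind (J [ g ]≔ true) in iJg
      ... | false = refl
      ... | true  = ⊥-elim (<⇒≱ (subst (_≤ cnt B) (cnt-add J g J∌g)
                                      (maximal-largest (J [ g ]≔ true) mB iJg (⊆-full (J [ g ]≔ true))))
                                 (maximal-largest B mJ (indep mB) B⊆Y))

    maximal-absorbs : ∀ {Z BZ J} g → MaxIn ind Z BZ → ind J ≡ true → BZ ⊆ J → J ∋ g → Z ∋ g → BZ ∋ g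
    maximal-absorbs {BZ = BZ} {J} g mBZ iJ BZ⊆J J∋g Z∋g = ¬∌ λ BZ∌g → true≢false (trans
      (sym (indep-hered _ J (add-⊆ BZ J g BZ⊆J J∋g) iJ)) (no-room mBZ g Z∋g BZ∌g))

    exchange-maximal : ∀ {Z BZ BZ'} W → MaxIn ind Z BZ → MaxIn ind Z BZ' →
      (∀ e → W ∋ e → Z ∌ e) → ind (W ∪ BZ') ≡ true → ind (W ∪ BZ) ≡ true
    exchange-maximal {Z} {BZ} {BZ'} W mBZ mBZ' W∩Z≡∅ iWBZ' =
      indep-hered (W ∪ BZ) J (⊆-cnt J (W ∪ BZ) J⊆WBZ size) (indep mJ)
      where
      extension = extend-to-maximal ind (W ∪ Z) BZ (indep mBZ) (λ g q → ∪-r W Z g (inside mBZ g q))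
      J    = proj₁ extension
      BZ⊆J = proj₁ (proj₂ extension)
      mJ   = proj₂ (proj₂ extension)
      J⊆WBZ : J ⊆ (W ∪ BZ)
      J⊆WBZ g J∋g with ∪-e W Z g (inside mJ g J∋g)
      ... | inj₁ W∋g = ∪-l W BZ g W∋g
      ... | inj₂ Z∋g = ∪-r W BZ g (maximal-absorbs g mBZ (indep mJ) BZ⊆J J∋g Z∋g)
      disjoint : ∀ V → V ⊆ Z → ∀ e → W ∋ e → V ∌ e
      disjoint V V⊆Z e W∋e = ¬∋ λ V∋e → true≢false (trans (sym (V⊆Z e V∋e)) (W∩Z≡∅ e W∋e))
      size : cnt (W ∪ BZ) ≤ cnt J
      size = begin
        cnt (W ∪ BZ)    ≡⟨ cnt-∪-disjoint W BZ (disjoint BZ (inside mBZ)) ⟩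
        cnt W + cnt BZ  ≤⟨ +-monoʳ-≤ (cnt W) (maximal-largest BZ mBZ' (indep mBZ) (inside mBZ)) ⟩
        cnt W + cnt BZ' ≡⟨ sym (cnt-∪-disjoint W BZ' (disjoint BZ' (inside mBZ'))) ⟩
        cnt (W ∪ BZ')   ≤⟨ maximal-largest (W ∪ BZ') mJ iWBZ'
                             (∪-⊆ W BZ' (W ∪ Z) (∪-l W Z) (λ g q → ∪-r W Z g (inside mBZ' g q))) ⟩
        cnt J           ∎
        where open ≤-Reasoning

  module _ {n : ℕ} (f : SetSys n) (hered : Hereditary f) where

    isBasis→maximal : ∀ B → isBasis f B ≡ true → MaxIn f full B
    isBasis→maximal B p with ∧-true {f B} p
    ... | fB , no-larger = maximal fB (⊆-full B) room
      where
      room : ∀ e → full ∋ e → B ∌ e → f (B [ e ]≔ true) ≡ false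
      room e _ B∌e with f (B [ e ]≔ true) in fBe
      ... | false = refl
      ... | true  = ⊥-elim (true≢false (trans (sym (lookup-add B e))
                      (trans (cong (λ Z → lookup Z e) (≟ᵇ→≡ (B [ e ]≔ true) B Be≟B)) B∌e)))
        where
        test-false : ∀ a b c → not (a ∧ b ∧ not c) ≡ true → a ≡ true → b ≡ true → c ≡ true
        test-false true true true _ _ _ = refl
        Be≟B = test-false (f (B [ e ]≔ true)) (B ⊆ᵇ (B [ e ]≔ true)) ((B [ e ]≔ true) ≟ᵇ B)
                 (all-elim _ (allSubsets n) (B [ e ]≔ true) (∈-allSubsets _) no-larger)
                 fBe (⊆→⊆ᵇ B (B [ e ]≔ true) (⊆-add B e))

    maximal→isBasis : ∀ B → MaxIn f full B → isBasis f B ≡ true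
    maximal→isBasis B (maximal fB _ room) rewrite fB = all-intro _ (allSubsets n) no-larger
      where
      test-true : ∀ a b c → (b ≡ true → c ≡ true) → not (a ∧ b ∧ not c) ≡ true
      test-true false b     c k = refl
      test-true true  false c k = refl
      test-true true  true  c k rewrite k refl = refl
      no-larger : ∀ Y → not (f Y ∧ (B ⊆ᵇ Y) ∧ not (Y ≟ᵇ B)) ≡ true
      no-larger Y with ⊆-dec Y B
      ... | inj₁ Y⊆B = test-true (f Y) (B ⊆ᵇ Y) (Y ≟ᵇ B) λ B⊆ᵇY →
        subst (λ Z → (Z ≟ᵇ B) ≡ true) (sym (⊆-antisym Y B Y⊆B (⊆ᵇ→⊆ B Y B⊆ᵇY))) (≟ᵇ-refl B)
      no-larger Y | inj₂ (e , Y∋e , B∌e) with f Y in fY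
      ... | false = refl
      ... | true with B ⊆ᵇ Y in B⊆ᵇY
      ...   | false = refl
      ...   | true = ⊥-elim (true≢false (trans
                (sym (hered _ Y (add-⊆ B Y e (⊆ᵇ→⊆ B Y B⊆ᵇY) Y∋e) fY))
                (room e (lookup-replicate e true) B∌e)))

-- The
-- contraction of Defs is  M/Z = (M*|E∖Z)*  with M* the dual by
-- complementation of bases; we show that, for any basis BZ of Z, X is
-- independent in M/Z exactly when X ∪ BZ is independent in M.
module Minors where

  open import Defs
  open FiniteSets
  open Relabelling
  open Independence
  open import Data.Bool using (true; false; _∧_)
  open import Data.Nat using (ℕ; _+_; _≤_; _<_)
  open import Data.Nat.Properties using (<⇒≱; ≤-trans; +-monoˡ-<; +-monoʳ-≤; +-cancelʳ-≤; module ≤-Reasoning)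
  open import Data.Vec using (lookup; _[_]≔_)
  open import Data.Vec.Properties using (lookup-replicate)
  open import Data.Fin using (_≟_)
  open import Data.Product using (∃; _×_; _,_; proj₁; proj₂)
  open import Data.Sum using (inj₁; inj₂)
  open import Data.Empty using (⊥; ⊥-elim)
  open import Relation.Nullary using (Dec; yes; no)
  open import Relation.Binary.PropositionalEquality hiding (J)

  restrict-matroid : ∀ {n} {ind : SetSys n} → IsMatroid ind → (A : Subset n) → IsMatroid (restrict ind A)
  restrict-matroid {n} {ind} M A = record
    { indep-empty = trans (cong ind (expand-∅ A)) indep-empty
    ; indep-hered = λ X Y X⊆Y → indep-hered (expand A X) (expand A Y) (expand-mono A X Y X⊆Y)
    ; indep-aug   = aug }
    where
    open IsMatroid M
    aug : ∀ X Y → ind (expand A X) ≡ true → ind (expand A Y) ≡ true → cnt X < cnt Y →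
          ∃ λ e → Y ∋ e × X ∌ e × ind (expand A (X [ e ]≔ true)) ≡ true
    aug X Y iX iY lt with indep-aug (expand A X) (expand A Y) iX iY
                            (subst₂ _<_ (sym (cnt-expand A X)) (sym (cnt-expand A Y)) lt)
    ... | e , Y∋e , X∌e , iXe with pos-onto A e (expand-⊆ A Y e Y∋e)
    ... | e' , refl = e' , trans (sym (lookup-expand A Y e')) Y∋e , trans (sym (lookup-expand A X e')) X∌e
                    , trans (cong ind (expand-add A X e')) iXe

  matroid-≗ : ∀ {n} {f g : SetSys n} → (∀ X → f X ≡ g X) → IsMatroid f → IsMatroid g
  matroid-≗ f≗g M = record
    { indep-empty = trans (sym (f≗g _)) indep-empty
    ; indep-hered = λ X Y s p → trans (sym (f≗g X)) (indep-hered X Y s (trans (f≗g Y) p))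
    ; indep-aug   = λ X Y p q lt →
        let (e , a , b , c) = indep-aug X Y (trans (f≗g X) p) (trans (f≗g Y) q) lt
        in  e , a , b , trans (sym (f≗g _)) c }
    where open IsMatroid M

  restrict-hereditary : ∀ {n} {f : SetSys n} → Hereditary f → (A : Subset n) → Hereditary (restrict f A)
  restrict-hereditary hf A X Y X⊆Y = hf (expand A X) (expand A Y) (expand-mono A X Y X⊆Y)

  module _ {n : ℕ} (f : SetSys n) (hf : Hereditary f) where

    dual-intro : ∀ {B} X → MaxIn f full B → X ⊆ compl B → dual f X ≡ true
    dual-intro {B} X mB X⊆B* = any-intro _ (allSubsets n) B (∈-allSubsets B)
      (subst₂ (λ a b → (a ∧ b) ≡ true)
        (sym (maximal→isBasis f hf B mB)) (sym (⊆→⊆ᵇ X (compl B) X⊆B*)) refl)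

    dual-elim : ∀ X → dual f X ≡ true → ∃ λ B → MaxIn f full B × X ⊆ compl B
    dual-elim X p with any-elim _ (allSubsets n) p
    ... | B , q with ∧-true {isBasis f B} q
    ... | isB , X⊆ᵇB* = B , isBasis→maximal f hf B isB , ⊆ᵇ→⊆ X (compl B) X⊆ᵇB*

    dual-hereditary : Hereditary (dual f)
    dual-hereditary X Y X⊆Y p with dual-elim Y p
    ... | B , mB , Y⊆B* = dual-intro X mB (⊆-trans X Y (compl B) X⊆Y Y⊆B*)

  -- Fixing a basis BZ of Z we show the familiar description
  --     X independent in M/Z  ⟺  X ∪ BZ independent in M,
  -- by matching the bases of M*|S with the complements in S of those bases
  -- of M that extend BZ.
  module Contraction {n : ℕ} {ind : SetSys n} (M : IsMatroid ind) (Z : Subset n) where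
    open IsMatroid M

    S : Subset n
    S = compl Z

    R : SetSys (cnt S)
    R = restrict (dual ind) S

    R-hereditary : Hereditary R
    R-hereditary = restrict-hereditary (dual-hereditary ind indep-hered) S

    expand-disjoint : ∀ V X e → V ⊆ Z → expand S X ∋ e → V ∌ e
    expand-disjoint V X e V⊆Z W∋e =
      ¬∋ λ V∋e → true≢false (trans (sym (expand-⊆ S X e W∋e)) (∋-compl Z e (V⊆Z e V∋e)))

    module _ {BZ : Subset n} (mBZ : MaxIn ind Z BZ) where

      -- A basis B of M extending BZ has the fewest elements outside Z among
      -- all bases: every basis meets Z in at most |BZ| = |B ∩ Z| elements,
      -- and all bases have the same size.
      fewest-outside-Z : ∀ {B B'} → MaxIn ind full B → BZ ⊆ B → MaxIn ind full B' →
                         cnt (B ∩ S) ≤ cnt (B' ∩ S)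
      fewest-outside-Z {B} {B'} mB BZ⊆B mB' = +-cancelʳ-≤ (cnt (B ∩ Z)) (cnt (B ∩ S)) (cnt (B' ∩ S)) (begin
        cnt (B ∩ S) + cnt (B ∩ Z)   ≡⟨ sym (cnt-split B Z) ⟩
        cnt B                        ≤⟨ maximal-largest M B mB' (indep mB) (⊆-full B) ⟩
        cnt B'                       ≡⟨ cnt-split B' Z ⟩
        cnt (B' ∩ S) + cnt (B' ∩ Z)  ≤⟨ +-monoʳ-≤ (cnt (B' ∩ S)) (≤-trans B'Z≤BZ BZ≤BZ) ⟩
        cnt (B' ∩ S) + cnt (B ∩ Z)   ∎)
        where
        open ≤-Reasoning
        B'Z≤BZ : cnt (B' ∩ Z) ≤ cnt BZ
        B'Z≤BZ = maximal-largest M (B' ∩ Z) mBZ (indep-hered (B' ∩ Z) B' (∩-l B' Z) (indep mB')) (∩-r B' Z)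
        BZ≤BZ : cnt BZ ≤ cnt (B ∩ Z)
        BZ≤BZ = cnt-⊆ BZ (B ∩ Z) (λ f p → ∩-i B Z f (BZ⊆B f p) (inside mBZ f p))

      -- If B is a basis of M extending BZ, then S ∖ B is a basis of M*|S:
      -- a coindependent C̃ + e would avoid a basis B' with fewer elements in S.
      complement-basis : ∀ {B} → MaxIn ind full B → BZ ⊆ B → MaxIn R full (shrink S (S ∩ compl B))
      complement-basis {B} mB BZ⊆B = maximal RC (⊆-full C) room
        where
        C̃ = S ∩ compl B
        C  = shrink S C̃
        eC : expand S C ≡ C̃
        eC = expand-shrink S C̃ (∩-l S (compl B))
        RC : R C ≡ true
        RC = trans (cong (dual ind) eC) (dual-intro ind indep-hered C̃ mB (∩-r S (compl B)))
        room : ∀ e' → full ∋ e' → C ∌ e' → R (C [ e' ]≔ true) ≡ false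
        room e' _ C∌e' = ¬∋ λ RCe → let (B' , mB' , C̃e⊆B'*) = witness RCe in
          <⇒≱ (cnt-strict (B' ∩ S) (B ∩ S) e (B'S⊆BS B' C̃e⊆B'*) (∩-i B S e B∋e (pos-∈ S e'))
                            (∩-∌l B' S e (compl-∋ B' e (C̃e⊆B'* e (lookup-add C̃ e)))))
              (fewest-outside-Z mB BZ⊆B mB')
          where
          e = pos S e'
          C̃∌e : C̃ ∌ e
          C̃∌e = trans (cong (λ V → lookup V e) (sym eC)) (trans (lookup-expand S C e') C∌e')
          B∋e : B ∋ e
          B∋e = ¬∌ λ B∌e →
            true≢false (trans (sym (∩-i S (compl B) e (pos-∈ S e') (compl-∌ B e B∌e))) C̃∌e)
          witness : R (C [ e' ]≔ true) ≡ true → ∃ λ B' → MaxIn ind full B' × (C̃ [ e ]≔ true) ⊆ compl B'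
          witness RCe = dual-elim ind indep-hered (C̃ [ e ]≔ true)
            (trans (cong (dual ind) (trans (cong (_[ e ]≔ true) (sym eC)) (sym (expand-add S C e')))) RCe)
          B'S⊆BS : ∀ B' → (C̃ [ e ]≔ true) ⊆ compl B' → (B' ∩ S) ⊆ (B ∩ S)
          B'S⊆BS B' C̃e⊆B'* f p = ∩-i B S f B∋f (∩-r B' S f p)
            where
            B∋f : B ∋ f
            B∋f = ¬∌ λ B∌f → true≢false (trans (sym (∩-l B' S f p)) (compl-∋ B' f
                    (C̃e⊆B'* f (⊆-add C̃ e f (∩-i S (compl B) f (∩-r B' S f p) (compl-∌ B f B∌f))))))

    module _ {C : Subset (cnt S)} {B : Subset n} (mC : MaxIn R full C) (mB : MaxIn ind full B)
             (C⊆B* : expand S C ⊆ compl B) where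
      private
        C̃ = expand S C

        C̃-saturated : ∀ e → S ∋ e → C̃ ∌ e → dual ind (C̃ [ e ]≔ true) ≡ false
        C̃-saturated e S∋e C̃∌e with pos-onto S e S∋e
        ... | e' , refl = trans (cong (dual ind) (sym (expand-add S C e')))
                                (no-room mC e' (lookup-replicate e' true) (trans (sym (lookup-expand S C e')) C̃∌e))

        avoiding-bases-contain : ∀ {J} → MaxIn ind full J → C̃ ⊆ compl J →
                                 ∀ e → S ∋ e → C̃ ∌ e → J ∋ e
        avoiding-bases-contain {J} mJ C̃⊆J* e S∋e C̃∌e = ¬∌ λ J∌e → true≢false (trans
          (sym (dual-intro ind indep-hered (C̃ [ e ]≔ true) mJ (add-⊆ C̃ (compl J) e C̃⊆J* (compl-∌ J e J∌e))))
          (C̃-saturated e S∋e C̃∌e))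

      avoids-only-C : ∀ e → S ∋ e → C̃ ∌ e → B ∋ e
      avoids-only-C = avoiding-bases-contain mB C⊆B*

      -- Otherwise some z ∈ Z ∖ B could be
      -- added to B ∩ Z; a maximal independent J with (B ∩ Z) + z ⊆ J ⊆ B + z is
      -- a basis avoiding C̃, hence contains all of S ∖ C̃ ⊇ B ∖ Z, so B + z ⊆ J.
      meets-Z-maximally : MaxIn ind Z (B ∩ Z)
      meets-Z-maximally = maximal (indep-hered (B ∩ Z) B (∩-l B Z) (indep mB)) (∩-r B Z) room
        where
        room : ∀ z → Z ∋ z → (B ∩ Z) ∌ z → ind ((B ∩ Z) [ z ]≔ true) ≡ false
        room z Z∋z BZ∌z = ¬∋ λ iBZz → let (J , BZz⊆J , mJ) = extension iBZz in
          basis-unextendable M J z mB (indep mJ) (B⊆J BZz⊆J mJ) (BZz⊆J z (lookup-add (B ∩ Z) z)) B∌z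
          where
          B∌z : B ∌ z
          B∌z = ¬∋ λ B∋z → true≢false (trans (sym (∩-i B Z z B∋z Z∋z)) BZ∌z)
          Bz = B [ z ]≔ true
          extension : ind ((B ∩ Z) [ z ]≔ true) ≡ true →
                      ∃ λ J → ((B ∩ Z) [ z ]≔ true) ⊆ J × MaxIn ind Bz J
          extension iBZz = extend-to-maximal ind Bz ((B ∩ Z) [ z ]≔ true) iBZz
                             (add-⊆ (B ∩ Z) Bz z (λ f q → ⊆-add B z f (∩-l B Z f q)) (lookup-add B z))
          C̃⊆Bz* : C̃ ⊆ compl Bz
          C̃⊆Bz* g C̃∋g = compl-∌ Bz g (¬∋ λ Bz∋g → case-on (z ≟ g) Bz∋g)
            where
            case-on : Dec (z ≡ g) → Bz ∋ g → ⊥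
            case-on (yes refl) _    = true≢false (trans (sym (expand-⊆ S C z C̃∋g)) (∋-compl Z z Z∋z))
            case-on (no z≢g)   Bz∋g = true≢false (trans (sym (trans (sym (lookup-add-other B z g z≢g)) Bz∋g))
                                                       (compl-∋ B g (C⊆B* g C̃∋g)))
          B⊆J : ∀ {J} → ((B ∩ Z) [ z ]≔ true) ⊆ J → MaxIn ind Bz J → B ⊆ J
          B⊆J {J} BZz⊆J mJ f B∋f with bool-cases (lookup Z f)
          ... | inj₁ Z∋f = BZz⊆J f (⊆-add (B ∩ Z) z f (∩-i B Z f B∋f Z∋f))
          ... | inj₂ Z∌f = avoiding-bases-contain (maximal-above-basis M mB (⊆-add B z) mJ)
                             (λ g C̃∋g → compl-∌ J g (¬∋ λ J∋g →
                                true≢false (trans (sym (inside mJ g J∋g)) (compl-∋ Bz g (C̃⊆Bz* g C̃∋g)))))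
                             f (compl-∌ Z f Z∌f)
                             (¬∋ λ C̃∋f → true≢false (trans (sym B∋f) (compl-∋ B f (C⊆B* f C̃∋f))))

    module _ {BZ : Subset n} (mBZ : MaxIn ind Z BZ) where

      -- X ∪ BZ independent ⇒ X independent in M/Z: extend X ∪ BZ to a basis B;
      -- then X avoids the basis S ∖ B of M*|S.
      independent⇒contract : ∀ X → ind (expand S X ∪ BZ) ≡ true → contract ind Z X ≡ true
      independent⇒contract X iWBZ = dual-intro R R-hereditary X (complement-basis mBZ mB BZ⊆B) X⊆C*
        where
        W = expand S X
        extension = extend-to-maximal ind full (W ∪ BZ) iWBZ (⊆-full (W ∪ BZ))
        B     = proj₁ extension
        WBZ⊆B = proj₁ (proj₂ extension)
        mB    = proj₂ (proj₂ extension)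
        BZ⊆B : BZ ⊆ B
        BZ⊆B e p = WBZ⊆B e (∪-r W BZ e p)
        X⊆C* : X ⊆ compl (shrink S (S ∩ compl B))
        X⊆C* e' p = compl-∌ (shrink S (S ∩ compl B)) e' (trans (sym (lookup-expand S _ e'))
          (trans (cong (λ V → lookup V (pos S e')) (expand-shrink S (S ∩ compl B) (∩-l S (compl B))))
            (∩-∌r S (compl B) (pos S e')
              (∋-compl B (pos S e') (WBZ⊆B (pos S e') (∪-l W BZ _ (trans (lookup-expand S X e') p)))))))

      -- X independent in M/Z ⇒ X ∪ BZ independent: X avoids a basis C of
      -- M*|S, and C̃ avoids a basis B of M; then X ⊆ B and B ∩ Z is a basis
      -- of Z, which may be exchanged for BZ.
      contract⇒independent : ∀ X → contract ind Z X ≡ true → ind (expand S X ∪ BZ) ≡ true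
      contract⇒independent X p with dual-elim R R-hereditary X p
      ... | C , mC , X⊆C* with dual-elim ind indep-hered (expand S C) (indep mC)
      ... | B , mB , C⊆B* =
        exchange-maximal M W mBZ (meets-Z-maximally mC mB C⊆B*) (λ e W∋e → compl-∋ Z e (expand-⊆ S X e W∋e))
          (indep-hered (W ∪ (B ∩ Z)) B (∪-⊆ W (B ∩ Z) B W⊆B (∩-l B Z)) (indep mB))
        where
        W = expand S X
        W⊆B : W ⊆ B
        W⊆B e W∋e with pos-onto S e (expand-⊆ S X e W∋e)
        ... | e' , refl = avoids-only-C mC mB C⊆B* (pos S e') (pos-∈ S e')
                (trans (lookup-expand S C e') (compl-∋ C e' (X⊆C* e' (trans (sym (lookup-expand S X e')) W∋e))))

      contract-via-basis : ∀ X → contract ind Z X ≡ ind (expand S X ∪ BZ)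
      contract-via-basis X = ⇔→≡ (contract⇒independent X) (independent⇒contract X)

    -- Hence M/Z is a matroid: it agrees with  X ↦ ind (expand S X ∪ BZ),
    -- which inherits the matroid axioms from M since BZ ⊆ Z is disjoint from S.
    module _ {BZ : Subset n} (mBZ : MaxIn ind Z BZ) where

      withBasis : SetSys (cnt S)
      withBasis X = ind (expand S X ∪ BZ)

      withBasis-matroid : IsMatroid withBasis
      withBasis-matroid = record
        { indep-empty = trans (cong (λ V → ind (V ∪ BZ)) (expand-∅ S)) (trans (cong ind (∅∪ BZ)) (indep mBZ))
        ; indep-hered = λ X Y X⊆Y → indep-hered (expand S X ∪ BZ) (expand S Y ∪ BZ)
            (∪-⊆ (expand S X) BZ (expand S Y ∪ BZ)
                 (λ e q → ∪-l (expand S Y) BZ e (expand-mono S X Y X⊆Y e q)) (∪-r (expand S Y) BZ))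
        ; indep-aug = aug }
        where
        WBZ : Subset (cnt S) → Subset n
        WBZ X = expand S X ∪ BZ
        cnt-WBZ : ∀ X → cnt (WBZ X) ≡ cnt X + cnt BZ
        cnt-WBZ X = trans (cnt-∪-disjoint (expand S X) BZ (λ e → expand-disjoint BZ X e (inside mBZ)))
                          (cong (_+ cnt BZ) (cnt-expand S X))
        aug : ∀ X Y → withBasis X ≡ true → withBasis Y ≡ true → cnt X < cnt Y →
              ∃ λ e' → Y ∋ e' × X ∌ e' × withBasis (X [ e' ]≔ true) ≡ true
        aug X Y iX iY lt with indep-aug (WBZ X) (WBZ Y) iX iY
                                (subst₂ _<_ (sym (cnt-WBZ X)) (sym (cnt-WBZ Y)) (+-monoˡ-< (cnt BZ) lt))
        ... | e , WBZY∋e , WBZX∌e , iXe with ∪-e (expand S Y) BZ e WBZY∋e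
        ...   | inj₂ BZ∋e = ⊥-elim (true≢false (trans (sym BZ∋e) (∪-∌ʳ (expand S X) BZ e WBZX∌e)))
        ...   | inj₁ W∋e with pos-onto S e (expand-⊆ S Y e W∋e)
        ...     | e' , refl =
          e' , trans (sym (lookup-expand S Y e')) W∋e
             , trans (sym (lookup-expand S X e')) (∪-∌ˡ (expand S X) BZ _ WBZX∌e)
             , trans (cong ind (trans (cong (_∪ BZ) (expand-add S X e')) (add-∪ (expand S X) BZ (pos S e')))) iXe

    basis-of-Z : ∃ λ BZ → ∅ ⊆ BZ × MaxIn ind Z BZ
    basis-of-Z = extend-to-maximal ind Z ∅ indep-empty (∅-⊆ Z)

    contract-matroid : IsMatroid (contract ind Z)
    contract-matroid = matroid-≗ (λ X → sym (contract-via-basis mBZ X)) (withBasis-matroid mBZ)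
      where mBZ = proj₂ (proj₂ basis-of-Z)

  open Contraction public using (contract-matroid)

module Rank where

  open import Defs
  open FiniteSets
  open Relabelling
  open Independence
  open Minors
  open import Data.Bool using (Bool; true; false; _∧_; not; if_then_else_)
  open import Data.Nat using (ℕ; _+_; _≤_; _⊔_; z≤n)
  open import Data.Nat.Properties
  open import Data.Vec using ([]; _∷_; lookup)
  open import Data.Vec.Properties using (lookup-replicate)
  open import Data.Fin using (Fin)
  open import Data.List using (List; []; _∷_)
  open import Data.List.Membership.Propositional using (_∈_)
  open import Data.List.Relation.Unary.Any using (here; there)
  open import Data.Product using (∃; _×_; _,_; proj₁; proj₂)
  open import Data.Sum using (_⊎_; inj₁; inj₂)
  open import Data.Empty using (⊥-elim)
  open import Relation.Binary.PropositionalEquality hiding (J)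

  rankL : ∀ {n} → SetSys n → Subset n → List (Subset n) → ℕ
  rankL f A []      = 0
  rankL f A (Y ∷ L) = if f Y ∧ (Y ⊆ᵇ A) then cnt Y ⊔ rankL f A L else rankL f A L

  rank : ∀ {n} → SetSys n → Subset n → ℕ
  rank {n} f A = rankL f A (allSubsets n)

  rk : ∀ {n} → SetSys n → ℕ
  rk f = rank f full

  private
    rankL-bound : ∀ {n} (f : SetSys n) A L Y → Y ∈ L → f Y ≡ true → Y ⊆ A → cnt Y ≤ rankL f A L
    rankL-bound f A (Y ∷ L) Y (here refl) fY Y⊆A rewrite fY | ⊆→⊆ᵇ Y A Y⊆A = m≤m⊔n (cnt Y) _
    rankL-bound f A (W ∷ L) Y (there m)   fY Y⊆A with f W ∧ (W ⊆ᵇ A)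
    ... | true  = ≤-trans (rankL-bound f A L Y m fY Y⊆A) (m≤n⊔m (cnt W) _)
    ... | false = rankL-bound f A L Y m fY Y⊆A

    rankL-attained : ∀ {n} (f : SetSys n) A L →
      (rankL f A L ≡ 0) ⊎ (∃ λ Y → f Y ≡ true × Y ⊆ A × rankL f A L ≡ cnt Y)
    rankL-attained f A [] = inj₁ refl
    rankL-attained f A (W ∷ L) with f W ∧ (W ⊆ᵇ A) in fW⊆A
    ... | false = rankL-attained f A L
    ... | true with ∧-true {f W} fW⊆A | rankL-attained f A L
    ...   | fW , W⊆ᵇA | inj₁ r≡0 =
      inj₂ (W , fW , ⊆ᵇ→⊆ W A W⊆ᵇA , trans (cong (cnt W ⊔_) r≡0) (⊔-identityʳ (cnt W)))
    ...   | fW , W⊆ᵇA | inj₂ (Y , fY , Y⊆A , r≡Y) with ≤-total (cnt W) (rankL f A L)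
    ...     | inj₁ W≤r = inj₂ (Y , fY , Y⊆A , trans (m≤n⇒m⊔n≡n W≤r) r≡Y)
    ...     | inj₂ r≤W = inj₂ (W , fW , ⊆ᵇ→⊆ W A W⊆ᵇA , m≥n⇒m⊔n≡m r≤W)

  rank-bound : ∀ {n} (f : SetSys n) A Y → f Y ≡ true → Y ⊆ A → cnt Y ≤ rank f A
  rank-bound {n} f A Y = rankL-bound f A (allSubsets n) Y (∈-allSubsets Y)

  rank-attained : ∀ {n} (f : SetSys n) A → f ∅ ≡ true → ∃ λ Y → f Y ≡ true × Y ⊆ A × rank f A ≡ cnt Y
  rank-attained {n} f A f∅ with rankL-attained f A (allSubsets n)
  ... | inj₁ r≡0 = ∅ , f∅ , ∅-⊆ A , trans r≡0 (sym (cnt-∅ {n}))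
  ... | inj₂ w   = w

  rank-unique : ∀ {n} (f : SetSys n) A r → f ∅ ≡ true →
    (∃ λ Y → f Y ≡ true × Y ⊆ A × cnt Y ≡ r) → (∀ Y → f Y ≡ true → Y ⊆ A → cnt Y ≤ r) →
    rank f A ≡ r
  rank-unique f A r f∅ (Y , fY , Y⊆A , Y≡r) bound with rank-attained f A f∅
  ... | W , fW , W⊆A , r≡W = ≤-antisym (subst (_≤ r) (sym r≡W) (bound W fW W⊆A))
                                        (subst (_≤ rank f A) Y≡r (rank-bound f A Y fY Y⊆A))

  rank-≗ : ∀ {n} (f g : SetSys n) A → (∀ X → f X ≡ g X) → rank f A ≡ rank g A
  rank-≗ {n} f g A f≗g = go (allSubsets n)
    where
    go : ∀ L → rankL f A L ≡ rankL g A L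
    go []      = refl
    go (W ∷ L) rewrite f≗g W | go L = refl

  rank-mono : ∀ {n} (f : SetSys n) A A' → f ∅ ≡ true → A ⊆ A' → rank f A ≤ rank f A'
  rank-mono f A A' f∅ A⊆A' with rank-attained f A f∅
  ... | Y , fY , Y⊆A , r≡Y = subst (_≤ rank f A') (sym r≡Y) (rank-bound f A' Y fY (⊆-trans Y A A' Y⊆A A⊆A'))

  rank≤cnt : ∀ {n} (f : SetSys n) A → f ∅ ≡ true → rank f A ≤ cnt A
  rank≤cnt f A f∅ with rank-attained f A f∅
  ... | Y , fY , Y⊆A , r≡Y = subst (_≤ cnt A) (sym r≡Y) (cnt-⊆ Y A Y⊆A)

  rank-maximal : ∀ {n} {ind : SetSys n} → IsMatroid ind → ∀ {A B} → MaxIn ind A B → rank ind A ≡ cnt B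
  rank-maximal {ind = ind} M {A} {B} mB = rank-unique ind A (cnt B) (IsMatroid.indep-empty M)
    (B , indep mB , inside mB , refl) (λ Y iY Y⊆A → maximal-largest M Y mB iY Y⊆A)

  rank-relabel : ∀ {n} (f : SetSys n) A X → f ∅ ≡ true → rank (restrict f A) X ≡ rank f (expand A X)
  rank-relabel f A X f∅ = ≤-antisym ≤-direction ≥-direction
    where
    ≤-direction : rank (restrict f A) X ≤ rank f (expand A X)
    ≤-direction with rank-attained (restrict f A) X (trans (cong f (expand-∅ A)) f∅)
    ... | Y , fY , Y⊆X , r≡Y = subst (_≤ _) (trans (cnt-expand A Y) (sym r≡Y))
                                 (rank-bound f (expand A X) (expand A Y) fY (expand-mono A Y X Y⊆X))
    ≥-direction : rank f (expand A X) ≤ rank (restrict f A) X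
    ≥-direction with rank-attained f (expand A X) f∅
    ... | Y , fY , Y⊆AX , r≡Y =
      subst (_≤ rank (restrict f A) X) (trans (sym (cnt-expand A (shrink A Y))) (trans (cong cnt es) (sym r≡Y)))
        (rank-bound (restrict f A) X (shrink A Y) (trans (cong f es) fY)
           (expand-reflects-⊆ A (shrink A Y) X (subst (_⊆ expand A X) (sym es) Y⊆AX)))
      where
      es : expand A (shrink A Y) ≡ Y
      es = expand-shrink A Y (⊆-trans Y (expand A X) A Y⊆AX (expand-⊆ A X))

  rk-restrict : ∀ {n} (ind : SetSys n) A → ind ∅ ≡ true → rk (restrict ind A) ≡ rank ind A
  rk-restrict ind A i∅ = trans (rank-relabel ind A full i∅) (cong (rank ind) (expand-full A))

  b01 : Bool → ℕ
  b01 true  = 1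
  b01 false = 0

  rk-one-element : ∀ {m} → m ≡ 1 → (N : SetSys m) → N ∅ ≡ true → rk N ≡ b01 (N full)
  rk-one-element refl N N∅ = by-cases (N full) refl
    where
    by-cases : ∀ b → N full ≡ b → rk N ≡ b01 b
    by-cases true  Nf = rank-unique N full 1 N∅ (full , Nf , ⊆-full full , refl) (λ Y _ _ → cnt≤n Y)
    by-cases false Nf = rank-unique N full 0 N∅ (∅ , N∅ , ⊆-full ∅ , refl) bound
      where
      bound : ∀ Y → N Y ≡ true → Y ⊆ full → cnt Y ≤ 0
      bound (false ∷ []) _  _ = z≤n
      bound (true ∷ [])  NY _ = ⊥-elim (true≢false (trans (sym NY) Nf))

  rank-singleton : ∀ {n} {ind : SetSys n} → IsMatroid ind → (e : Fin n) → rank ind ⁅ e ⁆ ≡ b01 (ind ⁅ e ⁆)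
  rank-singleton {ind = ind} M e =
    trans (sym (rk-restrict ind ⁅ e ⁆ i∅))
      (trans (rk-one-element (cnt-⁅⁆ e) (restrict ind ⁅ e ⁆) (trans (cong ind (expand-∅ ⁅ e ⁆)) i∅))
        (cong (λ V → b01 (ind V)) (expand-full ⁅ e ⁆)))
    where
    i∅ = IsMatroid.indep-empty M

  module _ {n : ℕ} {ind : SetSys n} (M : IsMatroid ind) (Z : Subset n) where
    open IsMatroid M
    open Contraction M Z using (S; contract-via-basis; basis-of-Z; expand-disjoint)

    rank-contract : ∀ X → rank (contract ind Z) X + rank ind Z ≡ rank ind (expand S X ∪ Z)
    rank-contract X = begin
        rank (contract ind Z) X + rank ind Z
          ≡⟨ cong₂ _+_ (trans (rank-≗ (contract ind Z) (restrict withBZ S) X (contract-via-basis mBZ))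
                              (rank-relabel withBZ S X withBZ-∅)) (rank-maximal M mBZ) ⟩
        rank withBZ W + cnt BZ
          ≡⟨ cong (_+ cnt BZ) rank-withBZ ⟩
        cnt Y + cnt BZ
          ≡⟨ sym cnt-J ⟩
        cnt J
          ≡⟨ sym (rank-maximal M mJ) ⟩
        rank ind (W ∪ Z) ∎
      where
      open ≡-Reasoning
      BZ  = proj₁ basis-of-Z
      mBZ = proj₂ (proj₂ basis-of-Z)
      W   = expand S X
      withBZ : SetSys n
      withBZ Y = ind (Y ∪ BZ)
      withBZ-∅ : withBZ ∅ ≡ true
      withBZ-∅ = trans (cong ind (∅∪ BZ)) (indep mBZ)
      extension = extend-to-maximal ind (W ∪ Z) BZ (indep mBZ) (λ f q → ∪-r W Z f (inside mBZ f q))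
      J     = proj₁ extension
      BZ⊆J  = proj₁ (proj₂ extension)
      mJ    = proj₂ (proj₂ extension)
      Y     = J ∩ S
      -- J meets Z exactly in BZ
      cnt-J : cnt J ≡ cnt Y + cnt BZ
      cnt-J = trans (cnt-split J Z) (cong (cnt Y +_) (cong cnt (⊆-antisym (J ∩ Z) BZ
                (λ g q → maximal-absorbs M g mBZ (indep mJ) BZ⊆J (∩-l J Z g q) (∩-r J Z g q))
                (λ g q → ∩-i J Z g (BZ⊆J g q) (inside mBZ g q)))))
      Y⊆W : Y ⊆ W
      Y⊆W g q with ∪-e W Z g (inside mJ g (∩-l J S g q))
      ... | inj₁ W∋g = W∋g
      ... | inj₂ Z∋g = ⊥-elim (true≢false (trans (sym (∩-r J S g q)) (∋-compl Z g Z∋g)))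
      rank-withBZ : rank withBZ W ≡ cnt Y
      rank-withBZ = rank-unique withBZ W (cnt Y) withBZ-∅
        (Y , indep-hered (Y ∪ BZ) J (∪-⊆ Y BZ J (∩-l J S) BZ⊆J) (indep mJ) , Y⊆W , refl)
        (λ Y' iY' Y'⊆W → +-cancelʳ-≤ (cnt BZ) (cnt Y') (cnt Y)
           (subst₂ _≤_ (cnt-∪-disjoint Y' BZ (λ e q → expand-disjoint BZ X e (inside mBZ) (Y'⊆W e q))) cnt-J
             (maximal-largest M (Y' ∪ BZ) mJ iY'
                (∪-⊆ Y' BZ (W ∪ Z) (λ g q → ∪-l W Z g (Y'⊆W g q)) (λ g q → ∪-r W Z g (inside mBZ g q))))))

    rk-contract : rk (contract ind Z) + rank ind Z ≡ rk ind
    rk-contract = trans (rank-contract full) (cong (rank ind) (ext _ _ covers))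
      where
      covers : ∀ e → lookup (expand S full ∪ Z) e ≡ lookup full e
      covers e rewrite expand-full S | lookup-∪ S Z e | lookup-compl Z e | lookup-replicate e true
        with lookup Z e
      ... | true  = refl
      ... | false = refl

  rk-contract-singleton : ∀ {n} {ind : SetSys n} → IsMatroid ind → (e : Fin n) →
    rk (contract ind ⁅ e ⁆) + b01 (ind ⁅ e ⁆) ≡ rk ind
  rk-contract-singleton {ind = ind} M e =
    trans (cong (rk (contract ind ⁅ e ⁆) +_) (sym (rank-singleton M e))) (rk-contract M ⁅ e ⁆)

  rk-empty : (ind : SetSys 0) → IsMatroid ind → rk ind ≡ 0
  rk-empty ind M = n≤0⇒n≡0 (rank≤cnt ind full (IsMatroid.indep-empty M))

module Coefficients where

  open import Defs
  open import Data.Bool using (true; false; _∧_; if_then_else_; T)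
  open import Data.Nat as ℕ using (ℕ; zero; suc; _∸_; _≤_; z≤n; s≤s; _≡ᵇ_; _≤ᵇ_; NonZero)
  import Data.Nat.Properties as ℕ
  open import Data.Integer as ℤ using (+_)
  import Data.Integer.Properties as ℤ
  open import Data.Rational using (ℚ; 0ℚ; 1ℚ; _+_; _*_; _-_; _/_; toℚᵘ)
  open import Data.Rational.Properties
    using (+-identityˡ; +-identityʳ; *-zeroˡ; *-zeroʳ; *-identityˡ; *-identityʳ;
           toℚᵘ-injective; toℚᵘ-fromℚᵘ; toℚᵘ-homo-*; toℚᵘ-homo-+)
  open import Data.Rational.Unnormalised as ℚᵘ using (mkℚᵘ; *≡*)
  import Data.Rational.Unnormalised.Properties as ℚᵘ
  open import Data.Rational.Solver using (module +-*-Solver)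
  open import Data.Sum using (_⊎_; inj₁; inj₂)
  open import Data.Empty using (⊥-elim)
  open import Relation.Nullary using (¬_; yes; no)
  open import Relation.Binary.PropositionalEquality
  open +-*-Solver using (solve; _:+_; _:*_; _:-_; _:=_)

  _≈P_ : Poly → Poly → Set
  p ≈P q = ∀ i j k → p i j k ≡ q i j k

  ι : ℕ → ℚ
  ι n = (+ n) / 1

  private
    ι-unnormalised : ∀ n → toℚᵘ (ι n) ℚᵘ.≃ mkℚᵘ (+ n) 0
    ι-unnormalised n = toℚᵘ-fromℚᵘ (mkℚᵘ (+ n) 0)

  ι-+ : ∀ a b → ι (a ℕ.+ b) ≡ ι a + ι b
  ι-+ a b = toℚᵘ-injective (ℚᵘ.≃-trans (ι-unnormalised (a ℕ.+ b))
    (ℚᵘ.≃-sym (ℚᵘ.≃-trans (toℚᵘ-homo-+ (ι a) (ι b))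
      (ℚᵘ.≃-trans (ℚᵘ.+-cong (ι-unnormalised a) (ι-unnormalised b))
        (*≡* (cong (ℤ._* (+ 1)) (trans (cong₂ ℤ._+_ (ℤ.*-identityʳ (+ a)) (ℤ.*-identityʳ (+ b)))
                                       (sym (ℤ.pos-+ a b)))))))))

  ι-* : ∀ a b → ι (a ℕ.* b) ≡ ι a * ι b
  ι-* a b = toℚᵘ-injective (ℚᵘ.≃-trans (ι-unnormalised (a ℕ.* b))
    (ℚᵘ.≃-sym (ℚᵘ.≃-trans (toℚᵘ-homo-* (ι a) (ι b))
      (ℚᵘ.≃-trans (ℚᵘ.*-cong (ι-unnormalised a) (ι-unnormalised b))
        (*≡* (cong (ℤ._* (+ 1)) (sym (ℤ.pos-* a b))))))))

  ι-inverse : ∀ d → .{{_ : NonZero d}} → ((+ 1) / d) * ι d ≡ 1ℚ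
  ι-inverse (suc d) = toℚᵘ-injective (ℚᵘ.≃-trans (toℚᵘ-homo-* ((+ 1) / suc d) (ι (suc d)))
    (ℚᵘ.≃-trans (ℚᵘ.*-cong (toℚᵘ-fromℚᵘ (mkℚᵘ (+ 1) d)) (ι-unnormalised (suc d)))
      (*≡* (cong +_ (cong suc (trans (ℕ.*-identityʳ (d ℕ.+ 0)) (sym (cong (ℕ._+ 0) (ℕ.*-identityʳ d)))))))))

  if-zero : ∀ c → (if c then 0ℚ else 0ℚ) ≡ 0ℚ
  if-zero true  = refl
  if-zero false = refl

  *-vanishˡ : ∀ {x} y → x ≡ 0ℚ → x * y ≡ 0ℚ
  *-vanishˡ y refl = *-zeroˡ y

  *-vanishʳ : ∀ x {y} → y ≡ 0ℚ → x * y ≡ 0ℚ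
  *-vanishʳ x refl = *-zeroʳ x

  ≡ᵇ-refl : ∀ a → (a ≡ᵇ a) ≡ true
  ≡ᵇ-refl zero    = refl
  ≡ᵇ-refl (suc a) = ≡ᵇ-refl a

  ≡ᵇ-true : ∀ a b → (a ≡ᵇ b) ≡ true → a ≡ b
  ≡ᵇ-true a b p = ℕ.≡ᵇ⇒≡ a b (subst T (sym p) _)

  ≡ᵇ-false : ∀ a b → a ≢ b → (a ≡ᵇ b) ≡ false
  ≡ᵇ-false a b a≢b with a ≡ᵇ b in eq
  ... | true  = ⊥-elim (a≢b (≡ᵇ-true a b eq))
  ... | false = refl

  ≤ᵇ-true : ∀ a b → (a ≤ᵇ b) ≡ true → a ≤ b
  ≤ᵇ-true a b p = ℕ.≤ᵇ⇒≤ a b (subst T (sym p) _)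

  ≤ᵇ-false : ∀ a b → (a ≤ᵇ b) ≡ false → ¬ (a ≤ b)
  ≤ᵇ-false a b p a≤b with ℕ.≤⇒≤ᵇ a≤b
  ... | t rewrite p = t

  sum-cong : ∀ n (f g : ℕ → ℚ) → (∀ a → a ≤ n → f a ≡ g a) → sumTo n f ≡ sumTo n g
  sum-cong zero    f g h = h 0 z≤n
  sum-cong (suc n) f g h = cong₂ _+_ (sum-cong n f g (λ a a≤n → h a (ℕ.m≤n⇒m≤1+n a≤n))) (h (suc n) ℕ.≤-refl)

  sum-zero : ∀ n (f : ℕ → ℚ) → (∀ a → a ≤ n → f a ≡ 0ℚ) → sumTo n f ≡ 0ℚ
  sum-zero zero    f h = h 0 z≤n
  sum-zero (suc n) f h rewrite sum-zero n f (λ a a≤n → h a (ℕ.m≤n⇒m≤1+n a≤n)) | h (suc n) ℕ.≤-refl = refl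

  sum-single : ∀ n (f : ℕ → ℚ) t → t ≤ n → (∀ a → a ≤ n → a ≢ t → f a ≡ 0ℚ) → sumTo n f ≡ f t
  sum-single zero f .zero z≤n h = refl
  sum-single (suc n) f t t≤ h with t ℕ.≟ suc n
  ... | yes refl rewrite sum-zero n f (λ a a≤n → h a (ℕ.m≤n⇒m≤1+n a≤n) (λ eq → ℕ.<⇒≢ (s≤s a≤n) eq)) =
    +-identityˡ _
  ... | no t≢ rewrite sum-single n f t (ℕ.≤-pred (ℕ.≤∧≢⇒< t≤ t≢)) (λ a a≤n → h a (ℕ.m≤n⇒m≤1+n a≤n))
                    | h (suc n) ℕ.≤-refl (λ eq → t≢ (sym eq)) = +-identityʳ _

  private
    interchange : ∀ a b c d → (a + b) + (c + d) ≡ (a + c) + (b + d)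
    interchange = solve 4 (λ a b c d → (a :+ b) :+ (c :+ d) := (a :+ c) :+ (b :+ d)) refl

    interchange- : ∀ a b c d → (a - b) + (c - d) ≡ (a + c) - (b + d)
    interchange- = solve 4 (λ a b c d → (a :- b) :+ (c :- d) := (a :+ c) :- (b :+ d)) refl

  sum-+ : ∀ n (f g : ℕ → ℚ) → sumTo n (λ a → f a + g a) ≡ sumTo n f + sumTo n g
  sum-+ zero    f g = refl
  sum-+ (suc n) f g rewrite sum-+ n f g = interchange (sumTo n f) (sumTo n g) (f (suc n)) (g (suc n))

  sum-- : ∀ n (f g : ℕ → ℚ) → sumTo n (λ a → f a - g a) ≡ sumTo n f - sumTo n g
  sum-- zero    f g = refl
  sum-- (suc n) f g rewrite sum-- n f g = interchange- (sumTo n f) (sumTo n g) (f (suc n)) (g (suc n))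

  sum3 : ℕ → ℕ → ℕ → (ℕ → ℕ → ℕ → ℚ) → ℚ
  sum3 i j k F = sumTo i λ a → sumTo j λ b → sumTo k λ c → F a b c

  sum3-cong : ∀ i j k F G → (∀ a b c → a ≤ i → b ≤ j → c ≤ k → F a b c ≡ G a b c) →
    sum3 i j k F ≡ sum3 i j k G
  sum3-cong i j k F G h = sum-cong i _ _ λ a a≤ → sum-cong j _ _ λ b b≤ → sum-cong k _ _ λ c c≤ → h a b c a≤ b≤ c≤

  sum3-zero : ∀ i j k F → (∀ a b c → a ≤ i → b ≤ j → c ≤ k → F a b c ≡ 0ℚ) → sum3 i j k F ≡ 0ℚ
  sum3-zero i j k F h = sum-zero i _ λ a a≤ → sum-zero j _ λ b b≤ → sum-zero k _ λ c c≤ → h a b c a≤ b≤ c≤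

  sum3-- : ∀ i j k F G → sum3 i j k (λ a b c → F a b c - G a b c) ≡ sum3 i j k F - sum3 i j k G
  sum3-- i j k F G = trans (sum-cong i _ _ λ a _ → trans (sum-cong j _ _ λ b _ → sum-- k _ _) (sum-- j _ _))
                           (sum-- i _ _)

  Off : ℕ → ℕ → ℕ → ℕ → ℕ → ℕ → Set
  Off a b c a₀ b₀ c₀ = a ≢ a₀ ⊎ b ≢ b₀ ⊎ c ≢ c₀

  sum3-single : ∀ i j k F a₀ b₀ c₀ → a₀ ≤ i → b₀ ≤ j → c₀ ≤ k →
    (∀ a b c → a ≤ i → b ≤ j → c ≤ k → Off a b c a₀ b₀ c₀ → F a b c ≡ 0ℚ) →
    sum3 i j k F ≡ F a₀ b₀ c₀
  sum3-single i j k F a₀ b₀ c₀ a₀≤ b₀≤ c₀≤ h =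
    trans (sum-single i _ a₀ a₀≤ (λ a a≤ a≢ → sum-zero j _ λ b b≤ → sum-zero k _ λ c c≤ → h a b c a≤ b≤ c≤ (inj₁ a≢)))
    (trans (sum-single j _ b₀ b₀≤ (λ b b≤ b≢ → sum-zero k _ λ c c≤ → h a₀ b c a₀≤ b≤ c≤ (inj₂ (inj₁ b≢))))
           (sum-single k _ c₀ c₀≤ (λ c c≤ c≢ → h a₀ b₀ c a₀≤ b₀≤ c≤ (inj₂ (inj₂ c≢)))))

  *P-congˡ : ∀ {u u'} p → u ≈P u' → (u *P p) ≈P (u' *P p)
  *P-congˡ p h i j k = sum3-cong i j k _ _ λ a b c _ _ _ → cong (_* p (i ∸ a) (j ∸ b) (k ∸ c)) (h a b c)

  *P-congʳ : ∀ u {p p'} → p ≈P p' → (u *P p) ≈P (u *P p')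
  *P-congʳ u h i j k = sum3-cong i j k _ _ λ a b c _ _ _ → cong (u a b c *_) (h (i ∸ a) (j ∸ b) (k ∸ c))

  *P--ˡ : ∀ u v p → ((u -P v) *P p) ≈P ((u *P p) -P (v *P p))
  *P--ˡ u v p i j k =
    trans (sum3-cong i j k _ _ λ a b c _ _ _ → distrib (u a b c) (v a b c) (p (i ∸ a) (j ∸ b) (k ∸ c)))
          (sum3-- i j k _ _)
    where
    distrib : ∀ a b c → (a - b) * c ≡ a * c - b * c
    distrib = solve 3 (λ a b c → (a :- b) :* c := a :* c :- b :* c) refl

  *P-zeroˡ : ∀ u p → u ≈P zeroP → (u *P p) ≈P zeroP
  *P-zeroˡ u p h i j k = sum3-zero i j k _ λ a b c _ _ _ →
    trans (cong (_* p (i ∸ a) (j ∸ b) (k ∸ c)) (h a b c)) (*-zeroˡ (p (i ∸ a) (j ∸ b) (k ∸ c)))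

  *P-zeroʳ : ∀ u p → p ≈P zeroP → (u *P p) ≈P zeroP
  *P-zeroʳ u p h i j k = sum3-zero i j k _ λ a b c _ _ _ →
    trans (cong (u a b c *_) (h (i ∸ a) (j ∸ b) (k ∸ c))) (*-zeroʳ (u a b c))

  *P-oneʳ : ∀ p → (p *P oneP) ≈P p
  *P-oneʳ p i j k =
    trans (sum3-single i j k _ i j k ℕ.≤-refl ℕ.≤-refl ℕ.≤-refl off)
          (trans (cong (p i j k *_) (cong₃ oneP (ℕ.n∸n≡0 i) (ℕ.n∸n≡0 j) (ℕ.n∸n≡0 k))) (*-identityʳ (p i j k)))
    where
    cong₃ : ∀ (f : ℕ → ℕ → ℕ → ℚ) {a a' b b' c c'} → a ≡ a' → b ≡ b' → c ≡ c' → f a b c ≡ f a' b' c'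
    cong₃ f refl refl refl = refl
    oneP-off : ∀ a b c → Off a b c 0 0 0 → oneP a b c ≡ 0ℚ
    oneP-off zero    zero    zero    (inj₁ a≢)        = ⊥-elim (a≢ refl)
    oneP-off zero    zero    zero    (inj₂ (inj₁ b≢)) = ⊥-elim (b≢ refl)
    oneP-off zero    zero    zero    (inj₂ (inj₂ c≢)) = ⊥-elim (c≢ refl)
    oneP-off zero    zero    (suc c) _ = refl
    oneP-off zero    (suc b) c       _ = refl
    oneP-off (suc a) b       c       _ = refl
    pos : ∀ a n → a ≤ n → a ≢ n → n ∸ a ≢ 0
    pos a n a≤n a≢n eq = a≢n (ℕ.≤-antisym a≤n (ℕ.m∸n≡0⇒m≤n eq))
    off : ∀ a b c → a ≤ i → b ≤ j → c ≤ k → Off a b c i j k → p a b c * oneP (i ∸ a) (j ∸ b) (k ∸ c) ≡ 0ℚ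
    off a b c a≤ b≤ c≤ o = trans (cong (p a b c *_) (oneP-off (i ∸ a) (j ∸ b) (k ∸ c) (pos' o))) (*-zeroʳ (p a b c))
      where
      pos' : Off a b c i j k → Off (i ∸ a) (j ∸ b) (k ∸ c) 0 0 0
      pos' (inj₁ a≢)        = inj₁ (pos a i a≤ a≢)
      pos' (inj₂ (inj₁ b≢)) = inj₂ (inj₁ (pos b j b≤ b≢))
      pos' (inj₂ (inj₂ c≢)) = inj₂ (inj₂ (pos c k c≤ c≢))

  _·P_ : ℚ → Poly → Poly
  (c ·P p) i j k = c * p i j k

  *P-scalarʳ : ∀ u c p → (u *P (c ·P p)) ≈P (c ·P (u *P p))
  *P-scalarʳ u c p i j k = trans (sum3-cong i j k _ _ λ a b d _ _ _ → swap (u a b d) c (p (i ∸ a) (j ∸ b) (k ∸ d)))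
                                 (sum3-scale i j k λ a b d → u a b d * p (i ∸ a) (j ∸ b) (k ∸ d))
    where
    swap : ∀ x y z → x * (y * z) ≡ y * (x * z)
    swap = solve 3 (λ x y z → x :* (y :* z) := y :* (x :* z)) refl
    distrib : ∀ x y z → x * y + x * z ≡ x * (y + z)
    distrib = solve 3 (λ x y z → x :* y :+ x :* z := x :* (y :+ z)) refl
    scale : ∀ n (f : ℕ → ℚ) → sumTo n (λ a → c * f a) ≡ c * sumTo n f
    scale zero    f = refl
    scale (suc n) f = trans (cong (_+ c * f (suc n)) (scale n f)) (distrib c (sumTo n f) (f (suc n)))
    sum3-scale : ∀ i j k F → sum3 i j k (λ a b d → c * F a b d) ≡ c * sum3 i j k F
    sum3-scale i j k F = trans (sum-cong i _ _ λ a _ → trans (sum-cong j _ _ λ b _ → scale k _) (scale j _)) (scale i _)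

  mon : ℕ → ℕ → ℕ → Poly
  mon a₀ b₀ c₀ a b c = if (a ≡ᵇ a₀) ∧ (b ≡ᵇ b₀) ∧ (c ≡ᵇ c₀) then 1ℚ else 0ℚ

  mon-off : ∀ a₀ b₀ c₀ a b c → Off a b c a₀ b₀ c₀ → mon a₀ b₀ c₀ a b c ≡ 0ℚ
  mon-off a₀ b₀ c₀ a b c o with a ≡ᵇ a₀ in e₁ | b ≡ᵇ b₀ in e₂ | c ≡ᵇ c₀ in e₃
  ... | false | _     | _     = refl
  ... | true  | false | _     = refl
  ... | true  | true  | false = refl
  ... | true  | true  | true with o
  ...   | inj₁ a≢        = ⊥-elim (a≢ (≡ᵇ-true _ _ e₁))
  ...   | inj₂ (inj₁ b≢) = ⊥-elim (b≢ (≡ᵇ-true _ _ e₂))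
  ...   | inj₂ (inj₂ c≢) = ⊥-elim (c≢ (≡ᵇ-true _ _ e₃))

  mon-on : ∀ a₀ b₀ c₀ → mon a₀ b₀ c₀ a₀ b₀ c₀ ≡ 1ℚ
  mon-on a₀ b₀ c₀ rewrite ≡ᵇ-refl a₀ | ≡ᵇ-refl b₀ | ≡ᵇ-refl c₀ = refl

  shift : ℕ → ℕ → ℕ → Poly → Poly
  shift a₀ b₀ c₀ p i j k =
    if (a₀ ≤ᵇ i) ∧ (b₀ ≤ᵇ j) ∧ (c₀ ≤ᵇ k) then p (i ∸ a₀) (j ∸ b₀) (k ∸ c₀) else 0ℚ

  mon-* : ∀ a₀ b₀ c₀ p → (mon a₀ b₀ c₀ *P p) ≈P shift a₀ b₀ c₀ p
  mon-* a₀ b₀ c₀ p i j k with a₀ ≤ᵇ i in e₁ | b₀ ≤ᵇ j in e₂ | c₀ ≤ᵇ k in e₃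
  ... | true | true | true =
    trans (sum3-single i j k _ a₀ b₀ c₀ (≤ᵇ-true _ _ e₁) (≤ᵇ-true _ _ e₂) (≤ᵇ-true _ _ e₃)
             λ a b c _ _ _ o → vanish a b c (mon-off a₀ b₀ c₀ a b c o))
          (trans (cong (_* p (i ∸ a₀) (j ∸ b₀) (k ∸ c₀)) (mon-on a₀ b₀ c₀)) (*-identityˡ _))
    where
    vanish : ∀ a b c → mon a₀ b₀ c₀ a b c ≡ 0ℚ → mon a₀ b₀ c₀ a b c * p (i ∸ a) (j ∸ b) (k ∸ c) ≡ 0ℚ
    vanish a b c m≡0 = trans (cong (_* p (i ∸ a) (j ∸ b) (k ∸ c)) m≡0) (*-zeroˡ (p (i ∸ a) (j ∸ b) (k ∸ c)))
  ... | false | _ | _ = sum3-zero i j k _ λ a b c a≤ _ _ →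
    trans (cong (_* p (i ∸ a) (j ∸ b) (k ∸ c)) (mon-off a₀ b₀ c₀ a b c (inj₁ λ { refl → ≤ᵇ-false _ _ e₁ a≤ })))
          (*-zeroˡ (p (i ∸ a) (j ∸ b) (k ∸ c)))
  ... | true | false | _ = sum3-zero i j k _ λ a b c _ b≤ _ →
    trans (cong (_* p (i ∸ a) (j ∸ b) (k ∸ c)) (mon-off a₀ b₀ c₀ a b c (inj₂ (inj₁ λ { refl → ≤ᵇ-false _ _ e₂ b≤ }))))
          (*-zeroˡ (p (i ∸ a) (j ∸ b) (k ∸ c)))
  ... | true | true | false = sum3-zero i j k _ λ a b c _ _ c≤ →
    trans (cong (_* p (i ∸ a) (j ∸ b) (k ∸ c)) (mon-off a₀ b₀ c₀ a b c (inj₂ (inj₂ λ { refl → ≤ᵇ-false _ _ e₃ c≤ }))))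
          (*-zeroˡ (p (i ∸ a) (j ∸ b) (k ∸ c)))

  monomial-* : ∀ u a₀ b₀ c₀ p → u ≈P mon a₀ b₀ c₀ → (u *P p) ≈P shift a₀ b₀ c₀ p
  monomial-* u a₀ b₀ c₀ p u≈m i j k = trans (*P-congˡ p u≈m i j k) (mon-* a₀ b₀ c₀ p i j k)

  oneP-mon : oneP ≈P mon 0 0 0
  oneP-mon zero    zero    zero    = refl
  oneP-mon zero    zero    (suc k) = refl
  oneP-mon zero    (suc j) k       = refl
  oneP-mon (suc i) j       k       = refl

  xP-mon : xP ≈P mon 1 0 0
  xP-mon zero          j       k       = refl
  xP-mon (suc zero)    zero    zero    = refl
  xP-mon (suc zero)    zero    (suc k) = refl
  xP-mon (suc zero)    (suc j) k       = refl
  xP-mon (suc (suc i)) j       k       = refl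

  yP-mon : yP ≈P mon 0 1 0
  yP-mon (suc i) j             k       = refl
  yP-mon zero    zero          k       = refl
  yP-mon zero    (suc zero)    zero    = refl
  yP-mon zero    (suc zero)    (suc k) = refl
  yP-mon zero    (suc (suc j)) k       = refl

  sP-mon : sP ≈P mon 0 0 1
  sP-mon (suc i) j       k             = refl
  sP-mon zero    (suc j) k             = refl
  sP-mon zero    zero    zero          = refl
  sP-mon zero    zero    (suc zero)    = refl
  sP-mon zero    zero    (suc (suc k)) = refl

  *P-oneˡ : ∀ p → (oneP *P p) ≈P p
  *P-oneˡ p = monomial-* oneP 0 0 0 p oneP-mon

  shift-cong : ∀ a b c p q → p ≈P q → shift a b c p ≈P shift a b c q
  shift-cong a b c p q p≈q i j k with a ≤ᵇ i | b ≤ᵇ j | c ≤ᵇ k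
  ... | true  | true  | true  = p≈q _ _ _
  ... | false | _     | _     = refl
  ... | true  | false | _     = refl
  ... | true  | true  | false = refl

  shift-- : ∀ a b c p q → shift a b c (p -P q) ≈P (shift a b c p -P shift a b c q)
  shift-- a b c p q i j k with a ≤ᵇ i | b ≤ᵇ j | c ≤ᵇ k
  ... | true  | true  | true  = refl
  ... | false | _     | _     = refl
  ... | true  | false | _     = refl
  ... | true  | true  | false = refl

  -- Multiplication by t of a one-variable coefficient sequence: f ↦ t·f.
  shf : (ℕ → ℚ) → ℕ → ℚ
  shf f zero    = 0ℚ
  shf f (suc i) = f i

  -- powm1 p j is the coefficient of t^j in (t - 1)^p, so that
  -- (t - 1)^{p+1} = t·(t - 1)^p - (t - 1)^p.
  powm1 : ℕ → ℕ → ℚ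
  powm1 zero    zero    = 1ℚ
  powm1 zero    (suc j) = 0ℚ
  powm1 (suc p) zero    = 0ℚ - powm1 p zero
  powm1 (suc p) (suc j) = powm1 p j - powm1 p (suc j)

  powm1-suc : ∀ p i → powm1 (suc p) i ≡ shf (powm1 p) i - powm1 p i
  powm1-suc p zero    = refl
  powm1-suc p (suc i) = refl

module SubsetSums where

  open import Defs
  open FiniteSets
  open Coefficients using (ι; ι-+)
  open import Data.Bool using (Bool; true; false; not; _∧_; _∨_; if_then_else_)
  open import Data.Nat using (ℕ; zero; suc)
  open import Data.Nat.Properties using (suc-injective)
  open import Data.Rational using (ℚ; 0ℚ; 1ℚ; _+_; _*_; _-_)
  open import Data.Rational.Properties using (+-identityˡ; +-identityʳ; +-assoc; +-comm; *-zeroˡ; +-0-commutativeMonoid)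
  open import Data.Rational.Solver using (module +-*-Solver)
  open import Data.Vec using ([]; _∷_; lookup)
  open import Data.Fin using (Fin; zero; suc)
  open import Data.List using (List; []; _∷_; map; _++_)
  open import Relation.Binary.PropositionalEquality
  open +-*-Solver using (solve; con; _:+_; _:*_; _:-_; _:=_)
  open import Algebra.Properties.CommutativeMonoid.Sum +-0-commutativeMonoid public
    using (sum; sum-cong-≗; ∑-distrib-+)

  ΣL : ∀ {A : Set} → (A → ℚ) → List A → ℚ
  ΣL g []      = 0ℚ
  ΣL g (x ∷ L) = g x + ΣL g L

  ΣS : (n : ℕ) → (Subset n → ℚ) → ℚ
  ΣS n g = ΣL g (allSubsets n)

  ΣF : (n : ℕ) → (Fin n → ℚ) → ℚ
  ΣF n = sum {n}

  sumL-coeff : ∀ {A : Set} (F : A → Poly) L i j k → sumL (map F L) i j k ≡ ΣL (λ x → F x i j k) L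
  sumL-coeff F []      i j k = refl
  sumL-coeff F (x ∷ L) i j k = cong (F x i j k +_) (sumL-coeff F L i j k)

  ΣL-++ : ∀ {A : Set} (g : A → ℚ) L L' → ΣL g (L ++ L') ≡ ΣL g L + ΣL g L'
  ΣL-++ g []      L' = sym (+-identityˡ _)
  ΣL-++ g (x ∷ L) L' rewrite ΣL-++ g L L' = sym (+-assoc (g x) (ΣL g L) (ΣL g L'))

  ΣL-map : ∀ {A B : Set} (g : B → ℚ) (h : A → B) L → ΣL g (map h L) ≡ ΣL (λ x → g (h x)) L
  ΣL-map g h []      = refl
  ΣL-map g h (x ∷ L) = cong (g (h x) +_) (ΣL-map g h L)

  ΣL-cong : ∀ {A : Set} {g h : A → ℚ} L → (∀ x → g x ≡ h x) → ΣL g L ≡ ΣL h L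
  ΣL-cong []      g≗h = refl
  ΣL-cong (x ∷ L) g≗h = cong₂ _+_ (g≗h x) (ΣL-cong L g≗h)

  ΣL-zero : ∀ {A : Set} {g : A → ℚ} L → (∀ x → g x ≡ 0ℚ) → ΣL g L ≡ 0ℚ
  ΣL-zero []      g≡0 = refl
  ΣL-zero (x ∷ L) g≡0 rewrite g≡0 x | ΣL-zero L g≡0 = refl

  ΣL-+ : ∀ {A : Set} (g h : A → ℚ) L → ΣL (λ x → g x + h x) L ≡ ΣL g L + ΣL h L
  ΣL-+ g h []      = refl
  ΣL-+ g h (x ∷ L) rewrite ΣL-+ g h L =
    solve 4 (λ a b c d → (a :+ b) :+ (c :+ d) := (a :+ c) :+ (b :+ d)) refl (g x) (h x) (ΣL g L) (ΣL h L)

  ΣL-- : ∀ {A : Set} (g h : A → ℚ) L → ΣL (λ x → g x - h x) L ≡ ΣL g L - ΣL h L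
  ΣL-- g h []      = refl
  ΣL-- g h (x ∷ L) rewrite ΣL-- g h L =
    solve 4 (λ a b c d → (a :- b) :+ (c :- d) := (a :+ c) :- (b :+ d)) refl (g x) (h x) (ΣL g L) (ΣL h L)

  ΣF-- : ∀ n (g h : Fin n → ℚ) → ΣF n (λ e → g e - h e) ≡ ΣF n g - ΣF n h
  ΣF-- zero    g h = refl
  ΣF-- (suc n) g h rewrite ΣF-- n (λ e → g (suc e)) (λ e → h (suc e)) =
    solve 4 (λ a b c d → (a :- b) :+ (c :- d) := (a :+ c) :- (b :+ d)) refl
      (g zero) (h zero) (ΣF n (λ e → g (suc e))) (ΣF n (λ e → h (suc e)))

  ΣF-const : ∀ n c → ΣF n (λ _ → c) ≡ ι n * c
  ΣF-const zero    c = sym (*-zeroˡ c)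
  ΣF-const (suc n) c rewrite ΣF-const n c | ι-+ 1 n =
    solve 2 (λ c x → c :+ x :* c := (con 1ℚ :+ x) :* c) refl c (ι n)

  ΣS-split : ∀ n (g : Subset (suc n) → ℚ) →
    ΣS (suc n) g ≡ ΣS n (λ A → g (false ∷ A)) + ΣS n (λ A → g (true ∷ A))
  ΣS-split n g = trans (ΣL-++ g (map (false ∷_) (allSubsets n)) (map (true ∷_) (allSubsets n)))
    (cong₂ _+_ (ΣL-map g (false ∷_) (allSubsets n)) (ΣL-map g (true ∷_) (allSubsets n)))

  sum-at-∅ : ∀ n (g : Subset n → ℚ) → (∀ A → cnt A ≢ 0 → g A ≡ 0ℚ) → ΣS n g ≡ g ∅
  sum-at-∅ zero    g h = +-identityʳ (g [])
  sum-at-∅ (suc n) g h = trans (ΣS-split n g)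
    (trans (cong₂ _+_ (sum-at-∅ n (λ A → g (false ∷ A)) (λ A → h (false ∷ A)))
                      (ΣL-zero (allSubsets n) (λ A → h (true ∷ A) (λ ()))))
           (+-identityʳ (g ∅)))

  sum-at-singletons : ∀ n (g : Subset n → ℚ) → (∀ A → cnt A ≢ 1 → g A ≡ 0ℚ) →
    ΣS n g ≡ ΣF n (λ e → g ⁅ e ⁆)
  sum-at-singletons zero    g h = cong (_+ 0ℚ) (h [] (λ ()))
  sum-at-singletons (suc n) g h = trans (ΣS-split n g)
    (trans (cong₂ _+_ (sum-at-singletons n (λ A → g (false ∷ A)) (λ A → h (false ∷ A)))
                      (sum-at-∅ n (λ A → g (true ∷ A)) (λ A ≢0 → h (true ∷ A) (λ eq → ≢0 (suc-injective eq)))))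
           (+-comm (ΣF n (λ e → g (false ∷ ⁅ e ⁆))) (g (true ∷ ∅))))

  sum-at-full : ∀ n (g : Subset n → ℚ) → (∀ A → cnt (compl A) ≢ 0 → g A ≡ 0ℚ) → ΣS n g ≡ g full
  sum-at-full zero    g h = +-identityʳ (g [])
  sum-at-full (suc n) g h = trans (ΣS-split n g)
    (trans (cong₂ _+_ (ΣL-zero (allSubsets n) (λ A → h (false ∷ A) (λ ())))
                      (sum-at-full n (λ A → g (true ∷ A)) (λ A → h (true ∷ A))))
           (+-identityˡ (g full)))

  sum-at-cosingletons : ∀ n (g : Subset n → ℚ) → (∀ A → cnt (compl A) ≢ 1 → g A ≡ 0ℚ) →
    ΣS n g ≡ ΣF n (λ e → g (compl ⁅ e ⁆))
  sum-at-cosingletons zero    g h = cong (_+ 0ℚ) (h [] (λ ()))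
  sum-at-cosingletons (suc n) g h = trans (ΣS-split n g)
    (trans (cong₂ _+_ (sum-at-full n (λ A → g (false ∷ A)) (λ A ≢0 → h (false ∷ A) (λ eq → ≢0 (suc-injective eq))))
                      (sum-at-cosingletons n (λ A → g (true ∷ A)) (λ A → h (true ∷ A))))
           (cong (_+ ΣF n (λ e → g (true ∷ compl ⁅ e ⁆))) (cong (λ V → g (false ∷ V)) (sym (compl-∅ {n})))))

  private
    when : Bool → ℚ → ℚ
    when b q = if b then q else 0ℚ

    subsets-of : ∀ {n} (B : Subset n) (g : Subset n → ℚ) →
      ΣS (cnt B) (λ X → g (expand B X)) ≡ ΣS n (λ A → when (A ⊆ᵇ B) (g A))
    subsets-of [] g = refl
    subsets-of {suc n} (true ∷ B) g = trans (ΣS-split (cnt B) _)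
      (trans (cong₂ _+_ (subsets-of B (λ A → g (false ∷ A))) (subsets-of B (λ A → g (true ∷ A))))
             (sym (ΣS-split n _)))
    subsets-of {suc n} (false ∷ B) g = trans (subsets-of B (λ A → g (false ∷ A)))
      (trans (sym (+-identityʳ _))
        (trans (cong (ΣS n (λ A → when (A ⊆ᵇ B) (g (false ∷ A))) +_) (sym (ΣL-zero (allSubsets n) (λ A → refl))))
               (sym (ΣS-split n _))))

    supersets-of : ∀ {n} (B : Subset n) (g : Subset n → ℚ) →
      ΣS (cnt B) (λ X → g (expand B X ∪ compl B)) ≡ ΣS n (λ A → when (compl B ⊆ᵇ A) (g A))
    supersets-of [] g = refl
    supersets-of {suc n} (true ∷ B) g = trans (ΣS-split (cnt B) _)
      (trans (cong₂ _+_ (supersets-of B (λ A → g (false ∷ A))) (supersets-of B (λ A → g (true ∷ A))))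
             (sym (ΣS-split n _)))
    supersets-of {suc n} (false ∷ B) g = trans (supersets-of B (λ A → g (true ∷ A)))
      (trans (sym (+-identityˡ _))
        (trans (cong (_+ ΣS n (λ A → when (compl B ⊆ᵇ A) (g (true ∷ A)))) (sym (ΣL-zero (allSubsets n) (λ A → refl))))
               (sym (ΣS-split n _))))

    ⊆ᵇ-cosingleton : ∀ {n} (A : Subset n) (e : Fin n) → (A ⊆ᵇ compl ⁅ e ⁆) ≡ not (lookup A e)
    ⊆ᵇ-cosingleton {suc n} (a ∷ A) zero rewrite compl-∅ {n} | ⊆→⊆ᵇ A full (⊆-full A) = by-cases a
      where
      by-cases : ∀ a → ((not a ∨ false) ∧ true) ≡ not a
      by-cases true  = refl
      by-cases false = refl
    ⊆ᵇ-cosingleton (a ∷ A) (suc e) rewrite ⊆ᵇ-cosingleton A e = by-cases a (not (lookup A e))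
      where
      by-cases : ∀ a c → ((not a ∨ true) ∧ c) ≡ c
      by-cases true  c = refl
      by-cases false c = refl

    singleton-⊆ᵇ : ∀ {n} (A : Subset n) (e : Fin n) → (⁅ e ⁆ ⊆ᵇ A) ≡ lookup A e
    singleton-⊆ᵇ (a ∷ A) zero rewrite ⊆→⊆ᵇ ∅ A (∅-⊆ A) = by-cases a
      where
      by-cases : ∀ a → ((false ∨ a) ∧ true) ≡ a
      by-cases true  = refl
      by-cases false = refl
    singleton-⊆ᵇ (a ∷ A) (suc e) = singleton-⊆ᵇ A e

    when-split : ∀ c x → when (not c) x + when c x ≡ x
    when-split true  x = +-identityˡ x
    when-split false x = +-identityʳ x

  split-at : ∀ {n} (e : Fin n) (g : Subset n → ℚ) →
    ΣS n g ≡ ΣS (cnt (compl ⁅ e ⁆)) (λ X → g (expand (compl ⁅ e ⁆) X))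
           + ΣS (cnt (compl ⁅ e ⁆)) (λ X → g (expand (compl ⁅ e ⁆) X ∪ ⁅ e ⁆))
  split-at {n} e g = sym (trans (cong₂ _+_ (subsets-of E∖e g)
      (trans (cong (λ V → ΣS (cnt E∖e) (λ X → g (expand E∖e X ∪ V))) (sym (compl-compl ⁅ e ⁆)))
             (supersets-of E∖e g)))
    (trans (sym (ΣL-+ _ _ (allSubsets n)))
      (ΣL-cong (allSubsets n) λ A →
        trans (cong₂ _+_ (cong (λ c → when c (g A)) (⊆ᵇ-cosingleton A e))
                         (cong (λ c → when c (g A)) (trans (cong (_⊆ᵇ A) (compl-compl ⁅ e ⁆)) (singleton-⊆ᵇ A e))))
              (when-split (lookup A e) (g A)))))
    where
    E∖e = compl ⁅ e ⁆

module Exponentials where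

  open import Defs
  open FiniteSets
  open Relabelling
  open Minors
  open Rank
  open Coefficients
  open SubsetSums
  open import Data.Bool using (Bool; true; false; if_then_else_)
  open import Data.Vec using ([]; _∷_)
  open import Data.Nat as ℕ using (ℕ; zero; suc; _∸_; _≤_; _≡ᵇ_; _!)
  import Data.Nat.Properties as ℕ
  open import Data.Nat.Properties using (_!≢0)
  open import Data.Integer using (+_)
  open import Data.Rational using (ℚ; 0ℚ; 1ℚ; _+_; _*_; _-_; _/_)
  open import Data.Rational.Properties using (*-zeroʳ; *-identityˡ; *-assoc; +-identityʳ; +-identityˡ)
  open import Data.Sum using (_⊎_; inj₁; inj₂)
  open import Data.Empty using (⊥-elim)
  open import Relation.Nullary using (yes; no)
  open import Relation.Binary.PropositionalEquality

  -- Power series of the shape  s^a · P(y)  and  s^b · Q(x).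
  inY : (ℕ → ℚ) → ℕ → Poly
  inY P a zero    j k = if k ≡ᵇ a then P j else 0ℚ
  inY P a (suc i) j k = 0ℚ

  inX : (ℕ → ℚ) → ℕ → Poly
  inX Q b i zero    k = if k ≡ᵇ b then Q i else 0ℚ
  inX Q b i (suc j) k = 0ℚ

  s·inY : ∀ P a → shift 0 0 1 (inY P a) ≈P inY P (suc a)
  s·inY P a zero    j zero    = refl
  s·inY P a zero    j (suc k) = refl
  s·inY P a (suc i) j zero    = refl
  s·inY P a (suc i) j (suc k) = refl

  ys·inY : ∀ P a → shift 0 1 1 (inY P a) ≈P inY (shf P) (suc a)
  ys·inY P a zero    zero    zero    = refl
  ys·inY P a zero    zero    (suc k) = sym (if-zero (k ≡ᵇ a))
  ys·inY P a zero    (suc j) zero    = refl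
  ys·inY P a zero    (suc j) (suc k) = refl
  ys·inY P a (suc i) zero    zero    = refl
  ys·inY P a (suc i) zero    (suc k) = refl
  ys·inY P a (suc i) (suc j) zero    = refl
  ys·inY P a (suc i) (suc j) (suc k) = refl

  s·inX : ∀ Q b → shift 0 0 1 (inX Q b) ≈P inX Q (suc b)
  s·inX Q b i zero    zero    = refl
  s·inX Q b i zero    (suc k) = refl
  s·inX Q b i (suc j) zero    = refl
  s·inX Q b i (suc j) (suc k) = refl

  xs·inX : ∀ Q b → shift 1 0 1 (inX Q b) ≈P inX (shf Q) (suc b)
  xs·inX Q b zero    zero    zero    = refl
  xs·inX Q b zero    zero    (suc k) = sym (if-zero (k ≡ᵇ b))
  xs·inX Q b zero    (suc j) zero    = refl
  xs·inX Q b zero    (suc j) (suc k) = refl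
  xs·inX Q b (suc i) zero    zero    = refl
  xs·inX Q b (suc i) zero    (suc k) = refl
  xs·inX Q b (suc i) (suc j) zero    = refl
  xs·inX Q b (suc i) (suc j) (suc k) = refl

  inY-cong : ∀ {P P'} a → (∀ j → P j ≡ P' j) → inY P a ≈P inY P' a
  inY-cong a P≗P' zero    j k = cong (λ v → if k ≡ᵇ a then v else 0ℚ) (P≗P' j)
  inY-cong a P≗P' (suc i) j k = refl

  inX-cong : ∀ {Q Q'} b → (∀ i → Q i ≡ Q' i) → inX Q b ≈P inX Q' b
  inX-cong b Q≗Q' i zero    k = cong (λ v → if k ≡ᵇ b then v else 0ℚ) (Q≗Q' i)
  inX-cong b Q≗Q' i (suc j) k = refl

  inY-- : ∀ P Q a → (inY P a -P inY Q a) ≈P inY (λ j → P j - Q j) a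
  inY-- P Q a zero    j k with k ≡ᵇ a
  ... | true  = refl
  ... | false = refl
  inY-- P Q a (suc i) j k = refl

  inX-- : ∀ P Q b → (inX P b -P inX Q b) ≈P inX (λ i → P i - Q i) b
  inX-- P Q b i zero    k with k ≡ᵇ b
  ... | true  = refl
  ... | false = refl
  inX-- P Q b i (suc j) k = refl

  inY-off : ∀ P a i j k → k ≢ a → inY P a i j k ≡ 0ℚ
  inY-off P a zero    j k k≢a rewrite ≡ᵇ-false k a k≢a = refl
  inY-off P a (suc i) j k k≢a = refl

  inX-off : ∀ Q b i j k → k ≢ b → inX Q b i j k ≡ 0ℚ
  inX-off Q b i zero    k k≢b rewrite ≡ᵇ-false k b k≢b = refl
  inX-off Q b i (suc j) k k≢b = refl

  1/! : ℕ → ℚ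
  1/! m = ((+ 1) / (m !)) {{m !≢0}}

  -- Writing  shape n r  for the claimed value on a
  -- matroid with n elements and rank r, the convolution powers are
  --     (s·D)^{⋆m}(M) = [m = n] · n! · shape n r,
  -- by induction on m: (s·D)^{⋆(m+1)}(M) = Σ_e (s·D)(M|e) · (s·D)^{⋆m}(M/e),
  -- and every element e contributes the same term since r(M/e) + [e not a
  -- loop] = r(M).  Dividing by m! gives  exp_⋆(s·D)(M) = shape n r.
  module ClosedForm
    (D : Fn)
    (W : Bool → Poly)
    (shape : ℕ → ℕ → Poly)
    (D-support : ∀ n (N : SetSys n) → n ≢ 1 → D n N ≈P zeroP)
    (D-one : ∀ {m} → m ≡ 1 → (N : SetSys m) → N ∅ ≡ true → (sP ·F D) m N ≈P W (N full))
    (shape-support : ∀ n r i j k → k ≢ n → shape n r i j k ≡ 0ℚ)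
    (shape-empty : shape 0 0 ≈P oneP)
    (shape-step : ∀ n r b → r ≤ n → (W b *P shape n r) ≈P shape (suc n) (r ℕ.+ b01 b))
    where

    power : ℕ → ℕ → ℕ → Poly
    power m n r i j k = if m ≡ᵇ n then ι (n !) * shape n r i j k else 0ℚ

    power-off : ∀ m n r i j k → m ≢ n ⊎ k ≢ n → power m n r i j k ≡ 0ℚ
    power-off m n r i j k (inj₁ m≢n) rewrite ≡ᵇ-false m n m≢n = refl
    power-off m n r i j k (inj₂ k≢n) with m ≡ᵇ n
    ... | true  = trans (cong (ι (n !) *_) (shape-support n r i j k k≢n)) (*-zeroʳ (ι (n !)))
    ... | false = refl

    private
      sD = sP ·F D

      step : ℕ → ℕ → ℕ → Poly
      step m n r i j k = if m ≡ᵇ n then ι (n !) * shape (suc n) r i j k else 0ℚ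

      -- the n + 1 elements contribute equally, and (n + 1) · n! = (n + 1)!
      sum-of-steps : ∀ m n r i j k → ΣF (suc n) (λ _ → step m n r i j k) ≡ power (suc m) (suc n) r i j k
      sum-of-steps m n r i j k rewrite ΣF-const (suc n) (step m n r i j k) with m ≡ᵇ n
      ... | true  = trans (sym (*-assoc (ι (suc n)) (ι (n !)) _))
                          (cong (_* shape (suc n) r i j k) (sym (ι-* (suc n) (n !))))
      ... | false = *-zeroʳ (ι (suc n))

      -- Given the closed form of the m-th power, the term of the (m+1)-st
      -- power at A = {e} is (s·D)(M|e) · (s·D)^{⋆m}(M/e) = W b · power m n r(M/e),
      -- where b says whether e is a non-loop, and r(M/e) + b = r(M).
      element-term : ∀ m → (∀ n (ind : SetSys n) → IsMatroid ind → pow⋆ sD m n ind ≈P power m n (rk ind)) →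
        ∀ {n} (ind : SetSys (suc n)) → IsMatroid ind → ∀ e →
        (sD (cnt ⁅ e ⁆) (restrict ind ⁅ e ⁆) *P pow⋆ sD m (cnt (compl ⁅ e ⁆)) (contract ind ⁅ e ⁆))
          ≈P step m n (rk ind)
      element-term m IH {n} ind M e i j k =
        trans (*P-congˡ (pow⋆ sD m (cnt (compl ⁅ e ⁆)) (contract ind ⁅ e ⁆))
                        (D-one (cnt-⁅⁆ e) (restrict ind ⁅ e ⁆) N∅) i j k)
          (trans (*P-congʳ (W b) contraction-power i j k) (by-cases (m ≡ᵇ n) refl))
        where
        b  = ind (expand ⁅ e ⁆ full)
        r' = rk (contract ind ⁅ e ⁆)
        N∅ : restrict ind ⁅ e ⁆ ∅ ≡ true
        N∅ = trans (cong ind (expand-∅ ⁅ e ⁆)) (IsMatroid.indep-empty M)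
        contraction-power : pow⋆ sD m (cnt (compl ⁅ e ⁆)) (contract ind ⁅ e ⁆) ≈P power m n r'
        contraction-power i j k = trans (IH _ (contract ind ⁅ e ⁆) (contract-matroid M ⁅ e ⁆) i j k)
                                        (cong (λ z → power m z r' i j k) (cnt-cosingleton e))
        rank-step : r' ℕ.+ b01 b ≡ rk ind
        rank-step = trans (cong (λ V → r' ℕ.+ b01 (ind V)) (expand-full ⁅ e ⁆)) (rk-contract-singleton M e)
        r'≤n : r' ≤ n
        r'≤n = ℕ.≤-trans (rank≤cnt (contract ind ⁅ e ⁆) full (IsMatroid.indep-empty (contract-matroid M ⁅ e ⁆)))
                         (ℕ.≤-reflexive (trans (cnt-full {cnt (compl ⁅ e ⁆)}) (cnt-cosingleton e)))
        by-cases : ∀ c → (m ≡ᵇ n) ≡ c → (W b *P power m n r') i j k ≡ step m n (rk ind) i j k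
        by-cases true  m≡n rewrite m≡n =
          trans (*P-scalarʳ (W b) (ι (n !)) (shape n r') i j k)
            (cong (ι (n !) *_) (trans (shape-step n r' b r'≤n i j k) (cong (λ r → shape (suc n) r i j k) rank-step)))
        by-cases false m≢n rewrite m≢n = *P-zeroʳ (W b) _ (λ _ _ _ → refl) i j k

    powers : ∀ m n (ind : SetSys n) → IsMatroid ind → pow⋆ sD m n ind ≈P power m n (rk ind)
    powers zero zero ind M i j k rewrite rk-empty ind M =
      sym (trans (cong (ι 1 *_) (shape-empty i j k)) (*-identityˡ (oneP i j k)))
    powers zero (suc n) ind M i j k = refl
    powers (suc m) n ind M i j k =
      trans (sumL-coeff term (allSubsets n) i j k)
        (trans (sum-at-singletons n (λ A → term A i j k) vanishes) (sum-over-elements n ind M))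
      where
      term : ∀ {n} {ind : SetSys n} → Subset n → Poly
      term {ind = ind} A = sD (cnt A) (restrict ind A) *P pow⋆ sD m (cnt (compl A)) (contract ind A)
      vanishes : ∀ A → cnt A ≢ 1 → term {ind = ind} A i j k ≡ 0ℚ
      vanishes A ≢1 = *P-zeroˡ _ (pow⋆ sD m (cnt (compl A)) (contract ind A))
                               (*P-zeroʳ sP _ (D-support (cnt A) (restrict ind A) ≢1)) i j k
      sum-over-elements : ∀ n (ind : SetSys n) → IsMatroid ind →
        ΣF n (λ e → term {ind = ind} ⁅ e ⁆ i j k) ≡ power (suc m) n (rk ind) i j k
      sum-over-elements zero    ind M = refl
      sum-over-elements (suc n) ind M =
        trans (sum-cong-≗ (λ e → element-term m (powers m) ind M e i j k)) (sum-of-steps m n (rk ind) i j k)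

    -- Hence exp_⋆(s·D)(M) = Σ_m (1/m!) (s·D)^{⋆m}(M) = shape n r(M): in the
    -- coefficient of s^K only the term m = K = n can survive.
    exponential : ∀ n (ind : SetSys n) → IsMatroid ind → expS D n ind ≈P shape n (rk ind)
    exponential n ind M i j K with K ℕ.≟ n
    ... | no K≢n = trans (sum-zero K _ λ m _ → vanish m (inj₂ K≢n)) (sym (shape-support n (rk ind) i j K K≢n))
      where
      vanish : ∀ m → m ≢ n ⊎ K ≢ n → 1/! m * pow⋆ sD m n ind i j K ≡ 0ℚ
      vanish m off = *-vanishʳ (1/! m) (trans (powers m n ind M i j K) (power-off m n (rk ind) i j K off))
    ... | yes refl = begin
      sumTo K (λ m → 1/! m * pow⋆ sD m K ind i j K)
        ≡⟨ sum-single K _ K ℕ.≤-refl (λ m _ m≢K → vanish m m≢K) ⟩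
      1/! K * pow⋆ sD K K ind i j K
        ≡⟨ cong (1/! K *_) (powers K K ind M i j K) ⟩
      1/! K * power K K (rk ind) i j K
        ≡⟨ cong (λ c → 1/! K * (if c then t else 0ℚ)) (≡ᵇ-refl K) ⟩
      1/! K * t
        ≡⟨ sym (*-assoc (1/! K) (ι (K !)) (shape K (rk ind) i j K)) ⟩
      (1/! K * ι (K !)) * shape K (rk ind) i j K
        ≡⟨ cong (_* shape K (rk ind) i j K) (ι-inverse (K !) {{K !≢0}}) ⟩
      1ℚ * shape K (rk ind) i j K
        ≡⟨ *-identityˡ _ ⟩
      shape K (rk ind) i j K ∎
      where
      open ≡-Reasoning
      t = ι (K !) * shape K (rk ind) i j K
      vanish : ∀ m → m ≢ K → 1/! m * pow⋆ sD m K ind i j K ≡ 0ℚ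
      vanish m m≢K = *-vanishʳ (1/! m) (trans (powers m K ind M i j K) (power-off m K (rk ind) i j K (inj₁ m≢K)))

  δA : Fn
  δA = δcoloop +F ((yP -P oneP) ·F δloop)

  δB : Fn
  δB = ((xP -P oneP) ·F δcoloop) +F δloop

  private
    shift-s-mon : ∀ a b c → shift 0 0 1 (mon a b c) ≈P mon a b (suc c)
    shift-s-mon a b c i j zero with i ≡ᵇ a | j ≡ᵇ b
    ... | false | _     = refl
    ... | true  | false = refl
    ... | true  | true  = refl
    shift-s-mon a b c i j (suc k) = refl

    s·mon-mon : ∀ p a b c a' b' c' → p ≈P (mon a b c -P mon a' b' c') →
      (sP *P p) ≈P (mon a b (suc c) -P mon a' b' (suc c'))
    s·mon-mon p a b c a' b' c' p≈ i j k =
      trans (monomial-* sP 0 0 1 p sP-mon i j k)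
        (trans (shift-cong 0 0 1 p _ p≈ i j k)
          (trans (shift-- 0 0 1 (mon a b c) (mon a' b' c') i j k)
            (cong₂ _-_ (shift-s-mon a b c i j k) (shift-s-mon a' b' c' i j k))))

    s·mon : ∀ p a b c → p ≈P mon a b c → (sP *P p) ≈P mon a b (suc c)
    s·mon p a b c p≈ i j k =
      trans (monomial-* sP 0 0 1 p sP-mon i j k)
        (trans (shift-cong 0 0 1 p _ p≈ i j k) (shift-s-mon a b c i j k))

    zero+u·0 : ∀ u → (zeroP +P (u *P zeroP)) ≈P zeroP
    zero+u·0 u i j k = trans (+-identityˡ _) (*P-zeroʳ u zeroP (λ _ _ _ → refl) i j k)

    u·0+zero : ∀ u → ((u *P zeroP) +P zeroP) ≈P zeroP
    u·0+zero u i j k = trans (+-identityʳ _) (*P-zeroʳ u zeroP (λ _ _ _ → refl) i j k)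

    -- s·δA and s·δB on a coloop (true) and on a loop (false)
    WA : Bool → Poly
    WA true  = mon 0 0 1
    WA false = mon 0 1 1 -P mon 0 0 1

    WB : Bool → Poly
    WB true  = mon 1 0 1 -P mon 0 0 1
    WB false = mon 0 0 1

    δA-support : ∀ n (N : SetSys n) → n ≢ 1 → δA n N ≈P zeroP
    δA-support zero          N _  = zero+u·0 (yP -P oneP)
    δA-support (suc zero)    N ≢1 = ⊥-elim (≢1 refl)
    δA-support (suc (suc n)) N _  = zero+u·0 (yP -P oneP)

    δB-support : ∀ n (N : SetSys n) → n ≢ 1 → δB n N ≈P zeroP
    δB-support zero          N _  = u·0+zero (xP -P oneP)
    δB-support (suc zero)    N ≢1 = ⊥-elim (≢1 refl)
    δB-support (suc (suc n)) N _  = u·0+zero (xP -P oneP)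

    δA-one : ∀ {m} → m ≡ 1 → (N : SetSys m) → N ∅ ≡ true → (sP ·F δA) m N ≈P WA (N full)
    δA-one refl N N∅ = by-cases (N full) refl
      where
      by-cases : ∀ b → N full ≡ b → (sP *P δA 1 N) ≈P WA b
      by-cases true Nf = s·mon _ 0 0 0 λ i j k → coloop i j k N∅ Nf
        where
        coloop : ∀ i j k → N (false ∷ []) ≡ true → N (true ∷ []) ≡ true → δA 1 N i j k ≡ mon 0 0 0 i j k
        coloop i j k N∅ Nf rewrite N∅ | Nf =
          trans (cong (λ v → oneP i j k + v) (*P-zeroʳ (yP -P oneP) zeroP (λ _ _ _ → refl) i j k))
                (trans (+-identityʳ _) (oneP-mon i j k))
      by-cases false Nf = s·mon-mon _ 0 1 0 0 0 0 λ i j k → loop i j k N∅ Nf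
        where
        loop : ∀ i j k → N (false ∷ []) ≡ true → N (true ∷ []) ≡ false → δA 1 N i j k ≡ (mon 0 1 0 -P mon 0 0 0) i j k
        loop i j k N∅ Nf rewrite N∅ | Nf =
          trans (+-identityˡ _) (trans (*P-oneʳ (yP -P oneP) i j k) (cong₂ _-_ (yP-mon i j k) (oneP-mon i j k)))

    δB-one : ∀ {m} → m ≡ 1 → (N : SetSys m) → N ∅ ≡ true → (sP ·F δB) m N ≈P WB (N full)
    δB-one refl N N∅ = by-cases (N full) refl
      where
      by-cases : ∀ b → N full ≡ b → (sP *P δB 1 N) ≈P WB b
      by-cases true Nf = s·mon-mon _ 1 0 0 0 0 0 λ i j k → coloop i j k N∅ Nf
        where
        coloop : ∀ i j k → N (false ∷ []) ≡ true → N (true ∷ []) ≡ true → δB 1 N i j k ≡ (mon 1 0 0 -P mon 0 0 0) i j k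
        coloop i j k N∅ Nf rewrite N∅ | Nf =
          trans (+-identityʳ _) (trans (*P-oneʳ (xP -P oneP) i j k) (cong₂ _-_ (xP-mon i j k) (oneP-mon i j k)))
      by-cases false Nf = s·mon _ 0 0 0 λ i j k → loop i j k N∅ Nf
        where
        loop : ∀ i j k → N (false ∷ []) ≡ true → N (true ∷ []) ≡ false → δB 1 N i j k ≡ mon 0 0 0 i j k
        loop i j k N∅ Nf rewrite N∅ | Nf =
          trans (cong (_+ oneP i j k) (*P-zeroʳ (xP -P oneP) zeroP (λ _ _ _ → refl) i j k))
                (trans (+-identityˡ _) (oneP-mon i j k))

    shapeA : ℕ → ℕ → Poly
    shapeA n r = inY (powm1 (n ∸ r)) n

    shapeB : ℕ → ℕ → Poly
    shapeB n r = inX (powm1 r) n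

    shapeA-empty : shapeA 0 0 ≈P oneP
    shapeA-empty zero    zero    zero    = refl
    shapeA-empty zero    (suc j) zero    = refl
    shapeA-empty zero    zero    (suc k) = refl
    shapeA-empty zero    (suc j) (suc k) = refl
    shapeA-empty (suc i) j       k       = refl

    shapeB-empty : shapeB 0 0 ≈P oneP
    shapeB-empty zero    zero    zero    = refl
    shapeB-empty (suc i) zero    zero    = refl
    shapeB-empty zero    zero    (suc k) = refl
    shapeB-empty (suc i) zero    (suc k) = refl
    shapeB-empty zero    (suc j) k       = refl
    shapeB-empty (suc i) (suc j) k       = refl

    shapeA-step : ∀ n r b → r ≤ n → (WA b *P shapeA n r) ≈P shapeA (suc n) (r ℕ.+ b01 b)
    shapeA-step n r true r≤n i j k =
      trans (mon-* 0 0 1 (shapeA n r) i j k)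
        (trans (s·inY (powm1 (n ∸ r)) n i j k)
               (cong (λ p → inY (powm1 p) (suc n) i j k) (cong (suc n ∸_) (sym (ℕ.+-comm r 1)))))
    shapeA-step n r false r≤n i j k =
      trans (*P--ˡ (mon 0 1 1) (mon 0 0 1) (shapeA n r) i j k)
        (trans (cong₂ _-_ (trans (mon-* 0 1 1 (shapeA n r) i j k) (ys·inY P n i j k))
                          (trans (mon-* 0 0 1 (shapeA n r) i j k) (s·inY P n i j k)))
          (trans (inY-- (shf P) P (suc n) i j k)
            (trans (inY-cong (suc n) (λ j → sym (powm1-suc (n ∸ r) j)) i j k)
              (cong (λ p → inY (powm1 p) (suc n) i j k)
                    (trans (sym (ℕ.+-∸-assoc 1 r≤n)) (cong (suc n ∸_) (sym (ℕ.+-identityʳ r))))))))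
      where P = powm1 (n ∸ r)

    shapeB-step : ∀ n r b → r ≤ n → (WB b *P shapeB n r) ≈P shapeB (suc n) (r ℕ.+ b01 b)
    shapeB-step n r true r≤n i j k =
      trans (*P--ˡ (mon 1 0 1) (mon 0 0 1) (shapeB n r) i j k)
        (trans (cong₂ _-_ (trans (mon-* 1 0 1 (shapeB n r) i j k) (xs·inX (powm1 r) n i j k))
                          (trans (mon-* 0 0 1 (shapeB n r) i j k) (s·inX (powm1 r) n i j k)))
          (trans (inX-- (shf (powm1 r)) (powm1 r) (suc n) i j k)
            (trans (inX-cong (suc n) (λ i → sym (powm1-suc r i)) i j k)
              (cong (λ p → inX (powm1 p) (suc n) i j k) (ℕ.+-comm 1 r)))))
    shapeB-step n r false r≤n i j k =
      trans (mon-* 0 0 1 (shapeB n r) i j k)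
        (trans (s·inX (powm1 r) n i j k) (cong (λ p → inX (powm1 p) (suc n) i j k) (sym (ℕ.+-identityʳ r))))

  exp-δA : ∀ n (ind : SetSys n) → IsMatroid ind → expS δA n ind ≈P inY (powm1 (n ∸ rk ind)) n
  exp-δA = ClosedForm.exponential δA WA shapeA δA-support δA-one
             (λ n r → inY-off (powm1 (n ∸ r)) n) shapeA-empty shapeA-step

  exp-δB : ∀ n (ind : SetSys n) → IsMatroid ind → expS δB n ind ≈P inX (powm1 (rk ind)) n
  exp-δB = ClosedForm.exponential δB WB shapeB δB-support δB-one
             (λ n r → inX-off (powm1 r) n) shapeB-empty shapeB-step

module Tutte where

  open import Defs
  open FiniteSets
  open Relabelling
  open Minors
  open Rank
  open Coefficients
  open SubsetSums
  open Exponentials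
  open import Data.Bool using (Bool; true; false; if_then_else_)
  open import Data.Nat as ℕ using (ℕ; zero; suc; _∸_; _≤_; _≡ᵇ_; z≤n)
  import Data.Nat.Properties as ℕ
  open import Data.Rational using (ℚ; 0ℚ; _+_; _*_; _-_)
  open import Data.Rational.Properties using (*-zeroˡ; *-zeroʳ)
  open import Data.Rational.Solver using (module +-*-Solver)
  open import Data.Fin using (Fin)
  open import Data.Sum using (inj₁; inj₂)
  open import Data.Empty using (⊥-elim)
  open import Relation.Nullary using (yes; no)
  open import Relation.Binary.PropositionalEquality
  open +-*-Solver using (solve; _:*_; _:-_; _:=_)

  tutte : ∀ {n} → SetSys n → ℕ → ℕ → ℚ
  tutte {n} ind i j = ΣS n (λ A → powm1 (cnt A ∸ rank ind A) j * powm1 (rk ind ∸ rank ind A) i)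

  private
    inY-offˣ : ∀ P a i j k → i ≢ 0 → inY P a i j k ≡ 0ℚ
    inY-offˣ P a zero    j k i≢0 = ⊥-elim (i≢0 refl)
    inY-offˣ P a (suc i) j k _   = refl

    inX-offʸ : ∀ Q b i j k → j ≢ 0 → inX Q b i j k ≡ 0ℚ
    inX-offʸ Q b i zero    k j≢0 = ⊥-elim (j≢0 refl)
    inX-offʸ Q b i (suc j) k _   = refl

  inY-*-inX : ∀ P a Q b i j k → (inY P a *P inX Q b) i j k ≡ (if k ≡ᵇ a ℕ.+ b then P j * Q i else 0ℚ)
  inY-*-inX P a Q b i j k with k ℕ.≟ a ℕ.+ b
  ... | yes refl rewrite ≡ᵇ-refl (a ℕ.+ b) = begin
    sum3 i j (a ℕ.+ b) term
      ≡⟨ sum3-single i j (a ℕ.+ b) term 0 j a z≤n ℕ.≤-refl (ℕ.m≤m+n a b) off ⟩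
    inY P a 0 j a * inX Q b i (j ∸ j) (a ℕ.+ b ∸ a)
      ≡⟨ cong₂ (λ u v → inY P a 0 j a * inX Q b i u v) (ℕ.n∸n≡0 j) (ℕ.m+n∸m≡n a b) ⟩
    inY P a 0 j a * inX Q b i 0 b
      ≡⟨ cong₂ _*_ (cong (λ c → if c then P j else 0ℚ) (≡ᵇ-refl a))
                   (cong (λ c → if c then Q i else 0ℚ) (≡ᵇ-refl b)) ⟩
    P j * Q i ∎
    where
    open ≡-Reasoning
    term : ℕ → ℕ → ℕ → ℚ
    term a' b' c' = inY P a a' b' c' * inX Q b (i ∸ a') (j ∸ b') (a ℕ.+ b ∸ c')
    off : ∀ a' b' c' → a' ≤ i → b' ≤ j → c' ≤ a ℕ.+ b → Off a' b' c' 0 j a → term a' b' c' ≡ 0ℚ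
    off a' b' c' _ _ _ (inj₁ a'≢0) = *-vanishˡ _ (inY-offˣ P a a' b' c' a'≢0)
    off a' b' c' _ b'≤j _ (inj₂ (inj₁ b'≢j)) = *-vanishʳ (inY P a a' b' c') (inX-offʸ Q b (i ∸ a') (j ∸ b') (a ℕ.+ b ∸ c')
                                                 (λ eq → b'≢j (ℕ.≤-antisym b'≤j (ℕ.m∸n≡0⇒m≤n eq))))
    off a' b' c' _ _ _ (inj₂ (inj₂ c'≢a)) = *-vanishˡ _ (inY-off P a a' b' c' c'≢a)
  ... | no k≢ rewrite ≡ᵇ-false k (a ℕ.+ b) k≢ = sum3-zero i j k _ off
    where
    off : ∀ a' b' c' → a' ≤ i → b' ≤ j → c' ≤ k → inY P a a' b' c' * inX Q b (i ∸ a') (j ∸ b') (k ∸ c') ≡ 0ℚ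
    off a' b' c' _ _ c'≤k with c' ℕ.≟ a
    ... | no c'≢a  = *-vanishˡ _ (inY-off P a a' b' c' c'≢a)
    ... | yes refl = *-vanishʳ (inY P c' a' b' c') (inX-off Q b (i ∸ a') (j ∸ b') (k ∸ c')
                                   (λ eq → k≢ (trans (sym (ℕ.m+[n∸m]≡n c'≤k)) (cong (c' ℕ.+_) eq))))

  α-closed : ∀ n (ind : SetSys n) → IsMatroid ind → ∀ i j k →
    α n ind i j k ≡ (if k ≡ᵇ n then tutte ind i j else 0ℚ)
  α-closed n ind M i j k =
    trans (sumL-coeff term (allSubsets n) i j k)
      (trans (ΣL-cong (allSubsets n) term-closed) (if-ΣL (k ≡ᵇ n) (allSubsets n)))
    where
    term : Subset n → Poly
    term A = expS δA (cnt A) (restrict ind A) *P expS δB (cnt (compl A)) (contract ind A)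
    summand : Subset n → ℚ
    summand A = powm1 (cnt A ∸ rank ind A) j * powm1 (rk ind ∸ rank ind A) i
    rk-contraction : ∀ A → rk (contract ind A) ≡ rk ind ∸ rank ind A
    rk-contraction A = trans (sym (ℕ.m+n∸n≡m (rk (contract ind A)) (rank ind A))) (cong (_∸ rank ind A) (rk-contract M A))
    term-closed : ∀ A → term A i j k ≡ (if k ≡ᵇ n then summand A else 0ℚ)
    term-closed A = begin
      term A i j k
        ≡⟨ *P-congˡ (expS δB (cnt (compl A)) (contract ind A))
                    (exp-δA (cnt A) (restrict ind A) (restrict-matroid M A)) i j k ⟩
      (inY (powm1 (cnt A ∸ rk (restrict ind A))) (cnt A) *P expS δB (cnt (compl A)) (contract ind A)) i j k
        ≡⟨ *P-congʳ (inY (powm1 (cnt A ∸ rk (restrict ind A))) (cnt A))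
                    (exp-δB (cnt (compl A)) (contract ind A) (contract-matroid M A)) i j k ⟩
      (inY (powm1 (cnt A ∸ rk (restrict ind A))) (cnt A) *P inX (powm1 (rk (contract ind A))) (cnt (compl A))) i j k
        ≡⟨ inY-*-inX _ (cnt A) _ (cnt (compl A)) i j k ⟩
      (if k ≡ᵇ cnt A ℕ.+ cnt (compl A)
        then powm1 (cnt A ∸ rk (restrict ind A)) j * powm1 (rk (contract ind A)) i else 0ℚ)
        ≡⟨ cong₂ (λ m v → if k ≡ᵇ m then v else 0ℚ) (cnt-compl A)
             (cong₂ (λ u v → powm1 (cnt A ∸ u) j * powm1 v i)
                    (rk-restrict ind A (IsMatroid.indep-empty M)) (rk-contraction A)) ⟩
      (if k ≡ᵇ n then summand A else 0ℚ) ∎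
      where open ≡-Reasoning
    if-ΣL : ∀ c L → ΣL (λ A → if c then summand A else 0ℚ) L ≡ (if c then ΣL summand L else 0ℚ)
    if-ΣL true  L = refl
    if-ΣL false L = ΣL-zero L (λ _ → refl)

  x· : (ℕ → ℕ → ℚ) → ℕ → ℕ → ℚ
  x· T i j = shf (λ i' → T i' j) i

  y· : (ℕ → ℕ → ℚ) → ℕ → ℕ → ℚ
  y· T i j = shf (λ j' → T i j') j

  private
    shf-ΣS : ∀ m (a : Subset m → ℚ) (f : Subset m → ℕ → ℚ) i →
      shf (λ i → ΣS m (λ X → a X * f X i)) i ≡ ΣS m (λ X → a X * shf (f X) i)
    shf-ΣS m a f zero    = sym (ΣL-zero (allSubsets m) (λ X → *-zeroʳ (a X)))
    shf-ΣS m a f (suc i) = refl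

    shf-ΣS' : ∀ m (a : Subset m → ℚ) (f : Subset m → ℕ → ℚ) j →
      shf (λ j → ΣS m (λ X → f X j * a X)) j ≡ ΣS m (λ X → shf (f X) j * a X)
    shf-ΣS' m a f zero    = sym (ΣL-zero (allSubsets m) (λ X → *-zeroˡ (a X)))
    shf-ΣS' m a f (suc j) = refl

    ∸-+-cancel : ∀ a c r → (a ℕ.+ r) ∸ (c ℕ.+ r) ≡ a ∸ c
    ∸-+-cancel a c r = trans (cong₂ _∸_ (ℕ.+-comm a r) (ℕ.+-comm c r)) (ℕ.[m+n]∸[m+o]≡n∸o r a c)

    *-distribˡ-- : ∀ a u v → a * (u - v) ≡ a * u - a * v
    *-distribˡ-- = solve 3 (λ a u v → a :* (u :- v) := a :* u :- a :* v) refl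

    *-distribʳ-- : ∀ a u v → (u - v) * a ≡ u * a - v * a
    *-distribʳ-- = solve 3 (λ a u v → (u :- v) :* a := u :* a :- v :* a) refl

  -- For an element e of M, split T_M according to
  -- whether A contains e: the subsets avoiding e give T_{M∖e}, multiplied
  -- by (x - 1) when e is a coloop; those containing e give T_{M/e},
  -- multiplied by (y - 1) when e is a loop.
  module DeletionContraction {n : ℕ} {ind : SetSys n} (M : IsMatroid ind) (e : Fin n) where
    private
      i∅  = IsMatroid.indep-empty M
      E∖e = compl ⁅ e ⁆

    deletion : SetSys (cnt E∖e)
    deletion = restrict ind E∖e

    contraction : SetSys (cnt E∖e)
    contraction = contract ind ⁅ e ⁆

    -- e is a coloop iff it is independent in M/(E∖e), and a non-loop iff {e} is independent
    isColoop : Bool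
    isColoop = contract ind E∖e full

    isNonloop : Bool
    isNonloop = ind ⁅ e ⁆

    private
      summand : ℕ → ℕ → Subset n → ℚ
      summand i j A = powm1 (cnt A ∸ rank ind A) j * powm1 (rk ind ∸ rank ind A) i

      rk-deletion : rk ind ≡ rk deletion ℕ.+ b01 isColoop
      rk-deletion = trans (sym (rk-contract M E∖e))
        (trans (ℕ.+-comm (rk (contract ind E∖e)) (rank ind E∖e))
          (cong₂ ℕ._+_ (sym (rk-restrict ind E∖e i∅))
             (rk-one-element (trans (cong cnt (compl-compl ⁅ e ⁆)) (cnt-⁅⁆ e)) (contract ind E∖e)
                (IsMatroid.indep-empty (contract-matroid M E∖e)))))

    -- the subsets avoiding e: A ⊆ E∖e has the same rank in M∖e, and the
    -- corank grows by one when e is a coloop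
    deletion-part : ∀ i j → ΣS (cnt E∖e) (λ X → summand i j (expand E∖e X))
      ≡ (if isColoop then x· (tutte deletion) i j - tutte deletion i j else tutte deletion i j)
    deletion-part i j = trans (ΣL-cong (allSubsets (cnt E∖e)) relabel) (by-cases isColoop)
      where
      corank : Subset (cnt E∖e) → ℕ
      corank X = rk deletion ∸ rank deletion X
      nullity : Subset (cnt E∖e) → ℕ
      nullity X = cnt X ∸ rank deletion X
      relabel : ∀ X → summand i j (expand E∖e X) ≡ powm1 (nullity X) j * powm1 (corank X ℕ.+ b01 isColoop) i
      relabel X = cong₂ (λ u v → powm1 u j * powm1 v i)
        (cong₂ _∸_ (cnt-expand E∖e X) (sym (rank-relabel ind E∖e X i∅)))
        (trans (cong₂ _∸_ rk-deletion (sym (rank-relabel ind E∖e X i∅)))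
               (ℕ.+-∸-comm (b01 isColoop)
                 (rank-mono deletion X full (trans (cong ind (expand-∅ E∖e)) i∅) (⊆-full X))))
      by-cases : ∀ c → ΣS (cnt E∖e) (λ X → powm1 (nullity X) j * powm1 (corank X ℕ.+ b01 c) i)
        ≡ (if c then x· (tutte deletion) i j - tutte deletion i j else tutte deletion i j)
      by-cases false = ΣL-cong (allSubsets (cnt E∖e)) λ X →
        cong (λ z → powm1 (nullity X) j * powm1 z i) (ℕ.+-identityʳ (corank X))
      by-cases true = trans (ΣL-cong (allSubsets (cnt E∖e)) λ X →
          trans (cong (λ z → powm1 (nullity X) j * powm1 z i) (ℕ.+-comm (corank X) 1))
            (trans (cong (powm1 (nullity X) j *_) (powm1-suc (corank X) i))
                   (*-distribˡ-- (powm1 (nullity X) j) (shf (powm1 (corank X)) i) (powm1 (corank X) i))))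
        (trans (ΣL-- _ _ (allSubsets (cnt E∖e)))
          (cong (_- tutte deletion i j) (sym (shf-ΣS (cnt E∖e) (λ X → powm1 (nullity X) j) (λ X → powm1 (corank X)) i))))

    -- the subsets containing e: A = X + e with r(X + e) = r_{M/e}(X) + [e not
    -- a loop], so the nullity grows by one when e is a loop
    contraction-part : ∀ i j → ΣS (cnt E∖e) (λ X → summand i j (expand E∖e X ∪ ⁅ e ⁆))
      ≡ (if isNonloop then tutte contraction i j else y· (tutte contraction) i j - tutte contraction i j)
    contraction-part i j = trans (ΣL-cong (allSubsets (cnt E∖e)) relabel) (by-cases isNonloop)
      where
      corank : Subset (cnt E∖e) → ℕ
      corank X = rk contraction ∸ rank contraction X
      disjoint : ∀ X f → expand E∖e X ∋ f → ⁅ e ⁆ ∌ f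
      disjoint X f p = compl-∋ ⁅ e ⁆ f (expand-⊆ E∖e X f p)
      size : ∀ X → cnt (expand E∖e X ∪ ⁅ e ⁆) ≡ cnt X ℕ.+ 1
      size X = trans (cnt-∪-disjoint (expand E∖e X) ⁅ e ⁆ (disjoint X)) (cong₂ ℕ._+_ (cnt-expand E∖e X) (cnt-⁅⁆ e))
      rank-with-e : ∀ X → rank ind (expand E∖e X ∪ ⁅ e ⁆) ≡ rank contraction X ℕ.+ b01 isNonloop
      rank-with-e X = trans (sym (rank-contract M ⁅ e ⁆ X)) (cong (rank contraction X ℕ.+_) (rank-singleton M e))
      rk-M : rk ind ≡ rk contraction ℕ.+ b01 isNonloop
      rk-M = trans (sym (rk-contract M ⁅ e ⁆)) (cong (rk contraction ℕ.+_) (rank-singleton M e))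
      relabel : ∀ X → summand i j (expand E∖e X ∪ ⁅ e ⁆)
        ≡ powm1 ((cnt X ℕ.+ 1) ∸ (rank contraction X ℕ.+ b01 isNonloop)) j * powm1 (corank X) i
      relabel X = cong₂ (λ u v → powm1 u j * powm1 v i) (cong₂ _∸_ (size X) (rank-with-e X))
        (trans (cong₂ _∸_ rk-M (rank-with-e X)) (∸-+-cancel (rk contraction) (rank contraction X) (b01 isNonloop)))
      by-cases : ∀ c → ΣS (cnt E∖e) (λ X → powm1 ((cnt X ℕ.+ 1) ∸ (rank contraction X ℕ.+ b01 c)) j * powm1 (corank X) i)
        ≡ (if c then tutte contraction i j else y· (tutte contraction) i j - tutte contraction i j)
      by-cases true = ΣL-cong (allSubsets (cnt E∖e)) λ X →
        cong (λ z → powm1 z j * powm1 (corank X) i) (∸-+-cancel (cnt X) (rank contraction X) 1)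
      by-cases false = trans (ΣL-cong (allSubsets (cnt E∖e)) λ X →
          trans (cong (λ z → powm1 z j * powm1 (corank X) i)
                   (trans (cong₂ _∸_ (ℕ.+-comm (cnt X) 1) (ℕ.+-identityʳ (rank contraction X)))
                          (ℕ.+-∸-assoc 1 (rank≤cnt contraction X (IsMatroid.indep-empty (contract-matroid M ⁅ e ⁆))))))
            (trans (cong (_* powm1 (corank X) i) (powm1-suc (cnt X ∸ rank contraction X) j))
                   (*-distribʳ-- (powm1 (corank X) i) (shf (powm1 (cnt X ∸ rank contraction X)) j)
                                 (powm1 (cnt X ∸ rank contraction X) j))))
        (trans (ΣL-- _ _ (allSubsets (cnt E∖e)))
          (cong (_- tutte contraction i j)
                (sym (shf-ΣS' (cnt E∖e) (λ X → powm1 (corank X) i) (λ X → powm1 (cnt X ∸ rank contraction X)) j))))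

    deletion-contraction : ∀ i j → tutte ind i j ≡
        (if isColoop then x· (tutte deletion) i j - tutte deletion i j else tutte deletion i j)
      + (if isNonloop then tutte contraction i j else y· (tutte contraction) i j - tutte contraction i j)
    deletion-contraction i j = trans (split-at e (summand i j)) (cong₂ _+_ (deletion-part i j) (contraction-part i j))

-- Convolving with δ_coloop or δ_loop only sees the one-element minors
-- M/(E∖e) and M|{e}, so it becomes a sum over the elements e.
module Convolutions where

  open import Defs
  open FiniteSets
  open Relabelling
  open Minors
  open Coefficients
  open SubsetSums
  open Tutte
  open import Data.Bool using (Bool; true; false; not; if_then_else_)
  open import Data.Nat using (zero; suc)
  open import Data.Rational using (0ℚ)
  open import Data.Empty using (⊥-elim)
  open import Relation.Binary.PropositionalEquality

  indicator : Bool → Poly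
  indicator b = if b then oneP else zeroP

  private
    *-indicator : ∀ p c i j k → (p *P indicator c) i j k ≡ (if c then p i j k else 0ℚ)
    *-indicator p true  = *P-oneʳ p
    *-indicator p false = *P-zeroʳ p zeroP (λ _ _ _ → refl)

    indicator-* : ∀ p c i j k → (indicator c *P p) i j k ≡ (if c then p i j k else 0ℚ)
    indicator-* p true  = *P-oneˡ p
    indicator-* p false = *P-zeroˡ zeroP p (λ _ _ _ → refl)

  -- Since
  -- M|A, resp. M/A, has one element exactly when A = E∖e, resp. A = {e}:
  --   (f ⋆ δ)(M) = Σ_e [test (e is a coloop)] f(M∖e),
  --   (δ ⋆ f)(M) = Σ_e [test (e is not a loop)] f(M/e).
  module OneElementCharacter (δ : Fn) (test : Bool → Bool)
    (vanishes : ∀ m (N : SetSys m) → m ≢ 1 → δ m N ≈P zeroP)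
    (on-one : ∀ {m} → m ≡ 1 → (N : SetSys m) → N ∅ ≡ true → δ m N ≈P indicator (test (N full)))
    where

    convolve-right : ∀ (f : Fn) n (ind : SetSys n) (M : IsMatroid ind) i j k →
      (f ⋆ δ) n ind i j k
        ≡ ΣF n (λ e → let open DeletionContraction M e in
                      if test isColoop then f _ deletion i j k else 0ℚ)
    convolve-right f n ind M i j k =
      trans (sumL-coeff term (allSubsets n) i j k)
        (trans (sum-at-cosingletons n (λ A → term A i j k)
                  (λ A ≢1 → *P-zeroʳ (f _ (restrict ind A)) _ (vanishes _ (contract ind A) ≢1) i j k))
               (sum-cong-≗ λ e → trans (*P-congʳ (f _ (restrict ind (compl ⁅ e ⁆)))
                                          (on-one (size e) (contract ind (compl ⁅ e ⁆))
                                                  (IsMatroid.indep-empty (contract-matroid M (compl ⁅ e ⁆)))) i j k)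
                                       (*-indicator (f _ (restrict ind (compl ⁅ e ⁆)))
                                                    (test (contract ind (compl ⁅ e ⁆) full)) i j k)))
      where
      term : Subset n → Poly
      term A = f (cnt A) (restrict ind A) *P δ (cnt (compl A)) (contract ind A)
      size : ∀ e → cnt (compl (compl ⁅ e ⁆)) ≡ 1
      size e = trans (cong cnt (compl-compl ⁅ e ⁆)) (cnt-⁅⁆ e)

    convolve-left : ∀ (f : Fn) n (ind : SetSys n) (M : IsMatroid ind) i j k →
      (δ ⋆ f) n ind i j k
        ≡ ΣF n (λ e → let open DeletionContraction M e in
                      if test isNonloop then f _ contraction i j k else 0ℚ)
    convolve-left f n ind M i j k =
      trans (sumL-coeff term (allSubsets n) i j k)
        (trans (sum-at-singletons n (λ A → term A i j k)
                  (λ A ≢1 → *P-zeroˡ _ (f _ (contract ind A)) (vanishes _ (restrict ind A) ≢1) i j k))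
               (sum-cong-≗ λ e → trans (*P-congˡ (f _ (contract ind ⁅ e ⁆))
                                          (on-one (cnt-⁅⁆ e) (restrict ind ⁅ e ⁆)
                                                  (trans (cong ind (expand-∅ ⁅ e ⁆)) (IsMatroid.indep-empty M))) i j k)
                                       (trans (indicator-* (f _ (contract ind ⁅ e ⁆))
                                                           (test (restrict ind ⁅ e ⁆ full)) i j k)
                                              (cong (λ B → if test (ind B) then f _ (contract ind ⁅ e ⁆) i j k
                                                                           else 0ℚ)
                                                    (expand-full ⁅ e ⁆)))))
      where
      term : Subset n → Poly
      term A = δ (cnt A) (restrict ind A) *P f (cnt (compl A)) (contract ind A)

  private
    δcoloop-vanishes : ∀ m (N : SetSys m) → m ≢ 1 → δcoloop m N ≈P zeroP
    δcoloop-vanishes zero          N _  _ _ _ = refl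
    δcoloop-vanishes (suc zero)    N ≢1 = ⊥-elim (≢1 refl)
    δcoloop-vanishes (suc (suc m)) N _  _ _ _ = refl

    δloop-vanishes : ∀ m (N : SetSys m) → m ≢ 1 → δloop m N ≈P zeroP
    δloop-vanishes zero          N _  _ _ _ = refl
    δloop-vanishes (suc zero)    N ≢1 = ⊥-elim (≢1 refl)
    δloop-vanishes (suc (suc m)) N _  _ _ _ = refl

    δcoloop-one : ∀ {m} → m ≡ 1 → (N : SetSys m) → N ∅ ≡ true → δcoloop m N ≈P indicator (N full)
    δcoloop-one refl N N∅ i j k rewrite N∅ = refl

    δloop-one : ∀ {m} → m ≡ 1 → (N : SetSys m) → N ∅ ≡ true → δloop m N ≈P indicator (not (N full))
    δloop-one refl N N∅ i j k rewrite N∅ = refl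

  module ByColoops = OneElementCharacter δcoloop (λ b → b) δcoloop-vanishes δcoloop-one
  module ByLoops   = OneElementCharacter δloop not δloop-vanishes δloop-one

module RightHandSide where

  open import Defs
  open Coefficients
  open SubsetSums
  open Tutte
  open Convolutions
  open import Data.Bool using (Bool; true; false; not; if_then_else_)
  open import Data.Nat as ℕ using (ℕ; zero; suc)
  open import Data.Rational using (ℚ; 0ℚ; _+_; _-_)
  open import Data.Rational.Properties using (*-zeroʳ)
  open import Data.Rational.Solver using (module +-*-Solver)
  open import Data.Fin using (Fin)
  open import Relation.Binary.PropositionalEquality
  open +-*-Solver using (solve; con; _:+_; _:-_; _:=_)

  Coeffs : Set
  Coeffs = ℕ → ℕ → ℚ

  onlyIf : Bool → Coeffs → Coeffs
  onlyIf c D i j = if c then D i j else 0ℚ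

  ode-term : Bool → Bool → Coeffs → Coeffs → Coeffs
  ode-term c b D C i j =
    ((x· (onlyIf c D) i j + y· (onlyIf (not b) C) i j) + (onlyIf b C i j - onlyIf c D i j))
      - (onlyIf (not b) C i j - onlyIf (not c) D i j)

  deletion-contraction-form : Bool → Bool → Coeffs → Coeffs → Coeffs
  deletion-contraction-form c b D C i j =
    (if c then x· D i j - D i j else D i j) + (if b then C i j else y· C i j - C i j)

  private
    x·-if : ∀ c (D : Coeffs) i j → x· (onlyIf c D) i j ≡ (if c then x· D i j else 0ℚ)
    x·-if true  D i       j = refl
    x·-if false D zero    j = refl
    x·-if false D (suc i) j = refl

    y·-if : ∀ c (C : Coeffs) i j → y· (onlyIf c C) i j ≡ (if c then y· C i j else 0ℚ)
    y·-if true  C i j       = refl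
    y·-if false C i zero    = refl
    y·-if false C i (suc j) = refl

  ode-term-expansion : ∀ c b D C i j → ode-term c b D C i j ≡ deletion-contraction-form c b D C i j
  ode-term-expansion c b D C i j rewrite x·-if c D i j | y·-if (not b) C i j = by-cases c b
    where
    by-cases : ∀ c b →
      ((((if c then x· D i j else 0ℚ) + (if not b then y· C i j else 0ℚ)) + (onlyIf b C i j - onlyIf c D i j))
        - (onlyIf (not b) C i j - onlyIf (not c) D i j)) ≡ deletion-contraction-form c b D C i j
    by-cases true  true  = solve 3 (λ xd d c → ((xd :+ con 0ℚ) :+ (c :- d)) :- (con 0ℚ :- con 0ℚ) := (xd :- d) :+ c)
                             refl (x· D i j) (D i j) (C i j)
    by-cases true  false = solve 4 (λ xd d yc c → ((xd :+ yc) :+ (con 0ℚ :- d)) :- (c :- con 0ℚ) := (xd :- d) :+ (yc :- c))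
                             refl (x· D i j) (D i j) (y· C i j) (C i j)
    by-cases false true  = solve 2 (λ d c → ((con 0ℚ :+ con 0ℚ) :+ (c :- con 0ℚ)) :- (con 0ℚ :- d) := d :+ c)
                             refl (D i j) (C i j)
    by-cases false false = solve 3 (λ d yc c → ((con 0ℚ :+ yc) :+ (con 0ℚ :- con 0ℚ)) :- (c :- d) := d :+ (yc :- c))
                             refl (D i j) (y· C i j) (C i j)

  deletion-contraction-form-cong : ∀ c b {D D' C C' : Coeffs} → (∀ i j → D i j ≡ D' i j) → (∀ i j → C i j ≡ C' i j) →
    ∀ i j → deletion-contraction-form c b D C i j ≡ deletion-contraction-form c b D' C' i j
  deletion-contraction-form-cong c b {D} {D'} {C} {C'} D≗D' C≗C' i j =
    cong₂ _+_ (cong₂ (λ xd d → if c then xd - d else d) (x·-cong i) (D≗D' i j))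
              (cong₂ (λ c' yc → if b then c' else yc - c') (C≗C' i j) (y·-cong j))
    where
    x·-cong : ∀ i → x· D i j ≡ x· D' i j
    x·-cong zero    = refl
    x·-cong (suc i) = D≗D' i j
    y·-cong : ∀ j → y· C i j ≡ y· C' i j
    y·-cong zero    = refl
    y·-cong (suc j) = C≗C' i j

  deletion-contraction-form-zero : ∀ c b i j → deletion-contraction-form c b (λ _ _ → 0ℚ) (λ _ _ → 0ℚ) i j ≡ 0ℚ
  deletion-contraction-form-zero c b i j =
    cong₂ _+_ (trans (cong (λ xd → if c then xd - 0ℚ else 0ℚ) (x·0 i)) (if-zero c))
              (trans (cong (λ yc → if b then 0ℚ else yc - 0ℚ) (y·0 j)) (if-zero b))
    where
    x·0 : ∀ i → x· (λ _ _ → 0ℚ) i j ≡ 0ℚ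
    x·0 zero    = refl
    x·0 (suc i) = refl
    y·0 : ∀ j → y· (λ _ _ → 0ℚ) i j ≡ 0ℚ
    y·0 zero    = refl
    y·0 (suc j) = refl

  RHS : Fn
  RHS = (((xP ·F (α ⋆ δcoloop)) +F (yP ·F (δloop ⋆ α))) +F [ δcoloop , α ]⋆) -F [ δloop , α ]⋆

  private
    xP-* : ∀ p i j k → (xP *P p) i j k ≡ x· (λ i j → p i j k) i j
    xP-* p i j k = trans (monomial-* xP 1 0 0 p xP-mon i j k) (shift-x i)
      where
      shift-x : ∀ i → shift 1 0 0 p i j k ≡ x· (λ i j → p i j k) i j
      shift-x zero    = refl
      shift-x (suc i) = refl

    yP-* : ∀ p i j k → (yP *P p) i j k ≡ y· (λ i j → p i j k) i j
    yP-* p i j k = trans (monomial-* yP 0 1 0 p yP-mon i j k) (shift-y j)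
      where
      shift-y : ∀ j → shift 0 1 0 p i j k ≡ y· (λ i j → p i j k) i j
      shift-y zero    = refl
      shift-y (suc j) = refl

    shf-cong : ∀ {f g : ℕ → ℚ} → (∀ i → f i ≡ g i) → ∀ i → shf f i ≡ shf g i
    shf-cong f≗g zero    = refl
    shf-cong f≗g (suc i) = f≗g i

    ΣF-zero : ∀ m → ΣF m (λ _ → 0ℚ) ≡ 0ℚ
    ΣF-zero m = trans (ΣF-const m 0ℚ) (*-zeroʳ (ι m))

    shf-ΣF : ∀ m (F : Fin m → ℕ → ℚ) i → shf (λ i → ΣF m (λ e → F e i)) i ≡ ΣF m (λ e → shf (F e) i)
    shf-ΣF m F zero    = sym (ΣF-zero m)
    shf-ΣF m F (suc i) = refl

    combine : ∀ m (a b c d f g : Fin m → ℚ) →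
      ((ΣF m a + ΣF m b) + (ΣF m c - ΣF m d)) - (ΣF m f - ΣF m g)
        ≡ ΣF m (λ e → ((a e + b e) + (c e - d e)) - (f e - g e))
    combine m a b c d f g = sym (trans (ΣF-- m _ _)
      (cong₂ _-_ (trans (∑-distrib-+ (λ e → a e + b e) (λ e → c e - d e))
                        (cong₂ _+_ (∑-distrib-+ a b) (ΣF-- m c d)))
                 (ΣF-- m f g)))

  RHS-as-sum : ∀ n (ind : SetSys n) (M : IsMatroid ind) i j k →
    RHS n ind i j k ≡ ΣF n (λ e → let open DeletionContraction M e in
      ode-term isColoop isNonloop (λ i j → α _ deletion i j k) (λ i j → α _ contraction i j k) i j)
  RHS-as-sum n ind M i j k =
    trans (cong₂ _-_ (cong₂ _+_ (cong₂ _+_ x-part y-part)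
                                (cong₂ _-_ (ByColoops.convolve-left α n ind M i j k)
                                           (ByColoops.convolve-right α n ind M i j k)))
                     (cong₂ _-_ (ByLoops.convolve-left α n ind M i j k) (ByLoops.convolve-right α n ind M i j k)))
          (combine n _ _ _ _ _ _)
    where
    x-part : (xP *P (α ⋆ δcoloop) n ind) i j k ≡ ΣF n (λ e → let open DeletionContraction M e in
               x· (onlyIf isColoop (λ i j → α _ deletion i j k)) i j)
    x-part = trans (xP-* ((α ⋆ δcoloop) n ind) i j k)
      (trans (shf-cong (λ i' → ByColoops.convolve-right α n ind M i' j k) i) (shf-ΣF n _ i))
    y-part : (yP *P (δloop ⋆ α) n ind) i j k ≡ ΣF n (λ e → let open DeletionContraction M e in
               y· (onlyIf (not isNonloop) (λ i j → α _ contraction i j k)) i j)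
    y-part = trans (yP-* ((δloop ⋆ α) n ind) i j k)
      (trans (shf-cong (λ j' → ByLoops.convolve-left α n ind M i j' k) j) (shf-ΣF n _ j))

open FiniteSets
open Coefficients
open SubsetSums
open Minors using (restrict-matroid; contract-matroid)
open Tutte
open RightHandSide
open import Data.Bool using (true; false; if_then_else_)
open import Data.Nat using (zero; suc; _≡ᵇ_)
open import Data.Rational using (ℚ; 0ℚ; _*_)
open import Data.Rational.Properties using (*-zeroʳ)
open import Data.Fin using (Fin)
open import Relation.Binary.PropositionalEquality using (cong; sym; trans; module ≡-Reasoning)

-- Both sides vanish on the empty matroid.  On a matroid with
-- n + 1 elements, the left-hand side is (n + 1) s^n T_M, and the
-- right-hand side is the sum over the n + 1 elements of s^n T_M.
private
  α-minor : ∀ {n} (e : Fin (suc n)) {N : SetSys (cnt (compl ⁅ e ⁆))} → IsMatroid N → ∀ i j k →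
    α _ N i j k ≡ (if k ≡ᵇ n then tutte N i j else 0ℚ)
  α-minor e {N} MN i j k =
    trans (α-closed _ N MN i j k) (cong (λ m → if k ≡ᵇ m then tutte N i j else 0ℚ) (cnt-cosingleton e))

  -- only the coefficient of s^n survives, so k + 1 may be replaced by n + 1
  degree : ∀ k n t → ι (suc k) * (if k ≡ᵇ n then t else 0ℚ) ≡ ι (suc n) * (if k ≡ᵇ n then t else 0ℚ)
  degree k n t with k ≡ᵇ n in k≡ᵇn
  ... | true  = cong (λ m → ι (suc m) * t) (≡ᵇ-true k n k≡ᵇn)
  ... | false = trans (*-zeroʳ (ι (suc k))) (sym (*-zeroʳ (ι (suc n))))

  element-contribution : ∀ {n} {ind : SetSys (suc n)} (M : IsMatroid ind) (e : Fin (suc n)) i j k →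
    (if k ≡ᵇ n then tutte ind i j else 0ℚ)
      ≡ (let open DeletionContraction M e in
         ode-term isColoop isNonloop (λ i j → α _ deletion i j k) (λ i j → α _ contraction i j k) i j)
  element-contribution {n} {ind} M e i j k =
    sym (trans (ode-term-expansion isColoop isNonloop
                  (λ i j → α _ deletion i j k) (λ i j → α _ contraction i j k) i j)
          (trans (deletion-contraction-form-cong isColoop isNonloop
                    (λ i j → α-minor e (restrict-matroid M (compl ⁅ e ⁆)) i j k)
                    (λ i j → α-minor e (contract-matroid M ⁅ e ⁆) i j k) i j)
                 (by-cases (k ≡ᵇ n))))
    where
    open DeletionContraction M e
    by-cases : ∀ kb → deletion-contraction-form isColoop isNonloop
                        (λ i j → if kb then tutte deletion i j else 0ℚ)
                        (λ i j → if kb then tutte contraction i j else 0ℚ) i j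
                      ≡ (if kb then tutte ind i j else 0ℚ)
    by-cases true  = sym (deletion-contraction i j)
    by-cases false = deletion-contraction-form-zero isColoop isNonloop i j

mainTheorem5 : (n : ℕ) (ind : SetSys n) → IsMatroid ind → (i j k : ℕ) →
  dds (α n ind) i j k
    ≡ ((((xP ·F (α ⋆ δcoloop)) +F (yP ·F (δloop ⋆ α)))
         +F [ δcoloop , α ]⋆) -F [ δloop , α ]⋆) n ind i j k
mainTheorem5 zero ind M i j k =
  trans (cong (ι (suc k) *_) (α-closed 0 ind M i j (suc k)))
        (trans (*-zeroʳ (ι (suc k))) (sym (RHS-as-sum 0 ind M i j k)))
mainTheorem5 (suc n) ind M i j k = begin
  dds (α (suc n) ind) i j k
    ≡⟨ cong (ι (suc k) *_) (α-closed (suc n) ind M i j (suc k)) ⟩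
  ι (suc k) * (if k ≡ᵇ n then tutte ind i j else 0ℚ)
    ≡⟨ degree k n (tutte ind i j) ⟩
  ι (suc n) * (if k ≡ᵇ n then tutte ind i j else 0ℚ)
    ≡⟨ sym (ΣF-const (suc n) _) ⟩
  ΣF (suc n) (λ _ → if k ≡ᵇ n then tutte ind i j else 0ℚ)
    ≡⟨ sum-cong-≗ (λ e → element-contribution M e i j k) ⟩
  ΣF (suc n) contribution
    ≡⟨ sym (RHS-as-sum (suc n) ind M i j k) ⟩
  RHS (suc n) ind i j k ∎
  where
  open ≡-Reasoning
  contribution : Fin (suc n) → ℚ
  contribution e = let open DeletionContraction M e in
    ode-term isColoop isNonloop (λ i j → α _ deletion i j k) (λ i j → α _ contraction i j k) i j
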